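{- Given two reactantless reaction systems $\mathcal{A}=(S,A),\mathcal{B}=(S,B)\in\mathcal{RS}(0,\infty)$ with a common background set $S$, it can be decided in polynomial time whether $\mathrm{res}_{\mathcal{A}}=\mathrm{res}_{\mathcal{B}}$.
   Context: A reaction over a finite set $S$ is a triple $a=(R_a,I_a,P_a)$ of subsets of $S$ (reactants, inhibitors, products) with $P_a\neq\varnothing$. A reaction system is a pair $\mathcal{A}=(S,A)$ with $S$ a finite background set and $A$ a set of reactions over $S$. A reaction $a$ is enabled in a state $T\subseteq S$ if $R_a\subseteq T$ and $I_a\cap T=\varnothing$. The result function is $\mathrm{res}_{\mathcal{A}}(T)=\bigcup\{P_a : a\in A \text{ enabled in } T\}$. $\mathcal{RS}(0,\infty)$ (reactantless systems) is the class of reaction systems in which every reaction has $R_a=\varnothing$. The input is given by explicitly listing $S$ and the reactions of both systems. -}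

module Defs where

open import Data.Nat using (ℕ; zero; suc; _+_; _*_; _^_)
open import Data.Bool using (Bool; true; false; if_then_else_)
import Data.Bool as Bool
open import Data.Fin using (Fin)
open import Data.Fin.Subset using (Subset; _⊆_; _∩_; _∪_; ⊥; Nonempty)
open import Data.Fin.Subset.Properties using (_⊆?_)
open import Data.Vec using (Vec; toList)
open import Data.Vec.Properties using (≡-dec)
open import Data.List using (List; []; _∷_; _++_; map; concatMap; replicate; length)
open import Data.List.Relation.Unary.All using (All)
open import Data.Maybe using (Maybe; just; nothing)
open import Data.Sum using (_⊎_)
open import Data.Product using (_×_; _,_)
open import Relation.Nullary using (Dec; does; _×-dec_)
open import Relation.Binary.PropositionalEquality using (_≡_)

record Reaction (n : ℕ) : Set where
  constructor reaction
  field
    R : Subset n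
    I : Subset n
    P : Subset n
open Reaction public

IsReaction : ∀ {n} → Reaction n → Set
IsReaction a = Nonempty (P a)

ReactionSystem : ℕ → Set
ReactionSystem n = List (Reaction n)

IsReactionSystem : ∀ {n} → ReactionSystem n → Set
IsReactionSystem A = All IsReaction A

-- membership in RS(0,∞): every reaction has empty reactant set
Reactantless : ∀ {n} → ReactionSystem n → Set
Reactantless A = All (λ a → R a ≡ ⊥) A

Enabled : ∀ {n} → Reaction n → Subset n → Set
Enabled a T = (R a ⊆ T) × (I a ∩ T ≡ ⊥)

enabled? : ∀ {n} (a : Reaction n) (T : Subset n) → Dec (Enabled a T)
enabled? a T = (R a ⊆? T) ×-dec ≡-dec Bool._≟_ (I a ∩ T) ⊥

res : ∀ {n} → ReactionSystem n → Subset n → Subset n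
res []      T = ⊥
res (a ∷ A) T = if does (enabled? a T) then P a ∪ res A T else res A T

-- Encoding of an instance (n, A, B) as a word over a 3-letter alphabet.
--   1^n # (1 R I P #)* # (1 R I P #)*
-- where each subset is written as its characteristic bit string of length n.

data Sym : Set where
  b0 b1 hash : Sym

encBit : Bool → Sym
encBit false = b0
encBit true  = b1

encSubset : ∀ {n} → Subset n → List Sym
encSubset p = map encBit (toList p)

encReaction : ∀ {n} → Reaction n → List Sym
encReaction a = b1 ∷ encSubset (R a) ++ encSubset (I a) ++ encSubset (P a) ++ hash ∷ []

encInstance : (n : ℕ) → ReactionSystem n → ReactionSystem n → List Sym
encInstance n A B =
  replicate n b1 ++ hash ∷ concatMap encReaction A ++ hash ∷ concatMap encReaction B

-- Deterministic Turing machines with a two-way infinite tape.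
-- Tape symbols: blank (nothing), input symbols, or k extra work symbols.

Γ : ℕ → Set
Γ k = Maybe (Sym ⊎ Fin k)

data Move : Set where
  left right stay : Move

data Action (q k : ℕ) : Set where
  halt : Bool → Action q k                     -- halt, accepting iff true
  go   : Fin q → Γ k → Move → Action q k

record TM : Set where
  field
    states  : ℕ
    extra   : ℕ
    start   : Fin states
    δ       : Fin states → Γ extra → Action states extra

record Config (M : TM) : Set where
  constructor conf
  field
    state : Fin (TM.states M)
    lft   : List (Γ (TM.extra M))    -- cells left of head, nearest first
    head  : Γ (TM.extra M)
    rgt   : List (Γ (TM.extra M))    -- cells right of head, nearest first

initConfig : (M : TM) → List Sym → Config M
initConfig M []      = conf (TM.start M) [] nothing []
initConfig M (s ∷ w) = conf (TM.start M) [] (just (Data.Sum.inj₁ s)) (map (λ x → just (Data.Sum.inj₁ x)) w)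

data StepResult (M : TM) : Set where
  halted  : Bool → StepResult M
  running : Config M → StepResult M

moveHead : ∀ {M} → Fin (TM.states M) → Γ (TM.extra M) → Move
         → List (Γ (TM.extra M)) → List (Γ (TM.extra M)) → Config M
moveHead q' x stay  l       r       = conf q' l x r
moveHead q' x left  []      r       = conf q' [] nothing (x ∷ r)
moveHead q' x left  (y ∷ l) r       = conf q' l y (x ∷ r)
moveHead q' x right l       []      = conf q' (x ∷ l) nothing []
moveHead q' x right l       (y ∷ r) = conf q' (x ∷ l) y r

step : (M : TM) → Config M → StepResult M
step M (conf q l h r) with TM.δ M q h
... | halt b      = halted b
... | go q' x mv  = running (moveHead {M} q' x mv l r)

run : (M : TM) → ℕ → Config M → Maybe Bool
run M zero    c = nothing
run M (suc t) c with step M c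
... | halted b  = just b
... | running c' = run M t c'

HaltsWithin : TM → ℕ → List Sym → Bool → Set
HaltsWithin M t w b = run M t (initConfig M w) ≡ just b

-- In a reactantless system a reaction a is enabled in T exactly when I_a ∩ T = ∅. Hence
-- res_A ⊆ res_B iff every a ∈ A is covered by B: each x ∈ P_a lies in P_b for some b ∈ B with
-- I_b ⊆ I_a (for the converse, evaluate both sides at T = ∁ I_a). Equality of the result functions
-- is covering in both directions, a check quadratic in the size of the input.
--
-- The machine M performs this check by sweeps over the encoded input w, each a right pass and a
-- return, 2|w| + 2 steps. The blocks of A and of B are taken in turn as the current block; each of
-- its 3n bits is read in one sweep, the header 1ⁿ counting the position within the field, and
-- applied in the next sweep to the same bit of every block on the other side. Guard bits (R, then I)
-- detect whether the guards of the current block are included in those of the target, and product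
-- bits of the target are marked covered when they are. The last sweep accepts iff every set bit is
-- marked. There are at most (|A| + |B|)(6n + 1) ≤ 2|w| sweeps, so M halts within 4(|w| + 1)² steps.

module Submission where

open import Defs
open import Relation.Binary.PropositionalEquality
open import Data.Nat using (ℕ; zero; suc; pred; _+_; _*_; _^_; _<_; z≤n; s≤s)
open import Data.Nat.Properties using (<-≤-trans; m<m+n; +-suc; +-comm; +-assoc; m≤m+n; +-monoˡ-<)
open import Data.Bool using (Bool; true; false; if_then_else_; not; _∧_; _∨_; _xor_)
open import Data.Fin using (Fin; zero; suc; _↑ˡ_; _↑ʳ_; splitAt; combine; remQuot)
open import Data.Fin.Properties using (splitAt-↑ˡ; splitAt-↑ʳ; remQuot-combine)
open import Data.List using (List; []; _∷_; _++_; map; length; replicate; concatMap)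
open import Data.Maybe using (Maybe; just; nothing)
open import Data.Sum using (_⊎_; inj₁; inj₂; [_,_]′)
open import Data.Product using (Σ; _×_; _,_; proj₁; proj₂; ∃; ∃₂)
open import Data.Unit using (⊤; tt)
open import Data.List.Properties using (map-cong; map-∘; map-id; length-map; map-++; ++-identityʳ; ++-assoc; length-replicate; length-++; ∷-injectiveˡ; ∷-injectiveʳ)
open import Data.Nat.Solver using (module +-*-Solver)
open import Data.List.Relation.Unary.All using (All; []; _∷_)
open import Data.Bool.Properties using (∨-zeroʳ; ∧-assoc; ∧-identityʳ; ∧-conicalˡ; ∧-conicalʳ)
open import Data.Vec using (Vec; toList; []; _∷_; lookup; zipWith)
open import Data.Vec.Properties using (toList-map; length-toList; []=⇒lookup; lookup⇒[]=; ≡-dec)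
open import Data.Empty using (⊥-elim)
open import Data.Fin.Subset using (Subset; ⊥; _∩_; _∪_; ∁; _⊆_; _∈_; _∉_)
open import Data.List.Relation.Unary.Any using (Any; here; there)
open import Relation.Nullary using (¬_; yes; no; contradiction)
open import Data.Fin.Subset.Properties
  using (_⊆?_; ∉⊥; ⊥⊆; ⊆-antisym; drop-∷-⊆; x∈p∩q⁺; x∈p∩q⁻; x∈p∪q⁺; x∈p∪q⁻; x∈p⇒x∉∁p; x∉∁p⇒x∈p)
open import Function.Bundles using (_⇔_; mk⇔)
open import Function.Construct.Symmetry using (⇔-sym)
open import Function.Construct.Composition using (_⇔-∘_)
open import Function using (_∘_)
import Data.Sum as Sum
import Data.Product as Prod
open +-*-Solver
import Data.List.Relation.Unary.All as All
import Data.Vec as V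
import Data.List.Relation.Unary.Any as Any
import Data.Bool as Bool

cong₃ : ∀ {A B C E : Set} (f : A → B → C → E) {a a′ b b′ c c′} → a ≡ a′ → b ≡ b′ → c ≡ c′ → f a b c ≡ f a′ b′ c′
cong₃ f refl refl refl = refl

zip-All-Any : ∀ {A : Set} {P Q : A → Set} {xs} → All P xs → Any Q xs → Any (λ x → P x × Q x) xs
zip-All-Any (px ∷ _)   (here qx) = here (px , qx)
zip-All-Any (_ ∷ pxs) (there q) = there (zip-All-Any pxs q)

-- Reactantless systems: equal result functions are mutual coverings

∩≡⊥⇒∉ : ∀ {n} {p q : Subset n} {x} → p ∩ q ≡ ⊥ → x ∈ p → x ∉ q
∩≡⊥⇒∉ p∩q≡⊥ x∈p x∈q = ∉⊥ (subst (_ ∈_) p∩q≡⊥ (x∈p∩q⁺ (x∈p , x∈q)))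

∉⇒∩≡⊥ : ∀ {n} {p q : Subset n} → (∀ {x} → x ∈ p → x ∉ q) → p ∩ q ≡ ⊥
∉⇒∩≡⊥ {p = p} {q} disjoint =
  ⊆-antisym (λ x∈p∩q → let x∈p , x∈q = x∈p∩q⁻ p q x∈p∩q in ⊥-elim (disjoint x∈p x∈q)) ⊥⊆

res-∷-enabled : ∀ {n} {a : Reaction n} {T} A → Enabled a T → res (a ∷ A) T ≡ P a ∪ res A T
res-∷-enabled {a = a} {T} A (R⊆T , I∩T≡⊥) with R a ⊆? T | ≡-dec Bool._≟_ (I a ∩ T) ⊥
... | yes _ | yes _ = refl
... | yes _ | no I∩T≢⊥ = contradiction I∩T≡⊥ I∩T≢⊥
... | no R⊈T | _ = contradiction (λ {x} → R⊆T {x}) R⊈T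

res-∷-disabled : ∀ {n} {a : Reaction n} {T} A → ¬ Enabled a T → res (a ∷ A) T ≡ res A T
res-∷-disabled {a = a} {T} A ¬enabled with R a ⊆? T | ≡-dec Bool._≟_ (I a ∩ T) ⊥
... | yes R⊆T | yes I∩T≡⊥ = contradiction ((λ {x} → R⊆T {x}) , I∩T≡⊥) ¬enabled
... | yes _ | no _ = refl
... | no _ | _ = refl

∈-res⁻ : ∀ {n} (A : ReactionSystem n) T {x} → x ∈ res A T → Any (λ a → Enabled a T × x ∈ P a) A
∈-res⁻ [] T x∈ = ⊥-elim (∉⊥ x∈)
∈-res⁻ (a ∷ A) T x∈ with enabled? a T
... | yes en = [ (λ x∈Pa → here (en , x∈Pa)) , there ∘ ∈-res⁻ A T ]′
                 (x∈p∪q⁻ (P a) (res A T) (subst (_ ∈_) (res-∷-enabled A en) x∈))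
... | no ¬en = there (∈-res⁻ A T (subst (_ ∈_) (res-∷-disabled A ¬en) x∈))

∈-res⁺ : ∀ {n} (A : ReactionSystem n) T {x} → Any (λ a → Enabled a T × x ∈ P a) A → x ∈ res A T
∈-res⁺ (a ∷ A) T (here (en , x∈Pa)) = subst (_ ∈_) (sym (res-∷-enabled A en)) (x∈p∪q⁺ (inj₁ x∈Pa))
∈-res⁺ (a ∷ A) T (there h) with enabled? a T
... | yes en = subst (_ ∈_) (sym (res-∷-enabled A en)) (x∈p∪q⁺ (inj₂ (∈-res⁺ A T h)))
... | no ¬en = subst (_ ∈_) (sym (res-∷-disabled A ¬en)) (∈-res⁺ A T h)

enabled-reactantless : ∀ {n} {T} (a : Reaction n) → R a ≡ ⊥ → (∀ {x} → x ∈ I a → x ∉ T) → Enabled a T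
enabled-reactantless {T = T} a Ra≡⊥ disjoint = subst (_⊆ T) (sym Ra≡⊥) ⊥⊆ , ∉⇒∩≡⊥ disjoint

enabled-antitone : ∀ {n} {T} (a b : Reaction n) → R b ≡ ⊥ → I b ⊆ I a → Enabled a T → Enabled b T
enabled-antitone a b Rb≡⊥ Ib⊆Ia (_ , Ia∩T≡⊥) = enabled-reactantless b Rb≡⊥ (λ x∈Ib → ∩≡⊥⇒∉ Ia∩T≡⊥ (Ib⊆Ia x∈Ib))

enabled-∁ : ∀ {n} (a : Reaction n) → R a ≡ ⊥ → Enabled a (∁ (I a))
enabled-∁ a Ra≡⊥ = enabled-reactantless a Ra≡⊥ x∈p⇒x∉∁p

enabled-∁⇒⊆ : ∀ {n} (a b : Reaction n) → Enabled b (∁ (I a)) → I b ⊆ I a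
enabled-∁⇒⊆ a b (_ , Ib∩∁Ia≡⊥) x∈Ib = x∉∁p⇒x∈p (∩≡⊥⇒∉ Ib∩∁Ia≡⊥ x∈Ib)

CoveredBy : ∀ {n} → ReactionSystem n → Reaction n → Set
CoveredBy B a = ∀ {x} → x ∈ P a → Any (λ b → I b ⊆ I a × x ∈ P b) B

covered⇒res⊆ : ∀ {n} {A B : ReactionSystem n} → Reactantless B → All (CoveredBy B) A →
  ∀ T → res A T ⊆ res B T
covered⇒res⊆ {A = A} {B} rB covA T x∈resA =
  ∈-res⁺ B T (Any.map (λ {b} (Rb≡⊥ , Ib⊆Ia , x∈Pb) → enabled-antitone a b Rb≡⊥ Ib⊆Ia a-enabled , x∈Pb)
                      (zip-All-Any rB (a-covered x∈Pa)))
  where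
  producer = ∈-res⁻ A T x∈resA
  a = Any.lookup producer
  a-covered : CoveredBy B a
  a-covered = proj₁ (All.lookupAny covA producer)
  a-enabled = proj₁ (proj₂ (All.lookupAny covA producer))
  x∈Pa = proj₂ (proj₂ (All.lookupAny covA producer))

res⊆⇒covered : ∀ {n} {A B : ReactionSystem n} → Reactantless A → (∀ T → res A T ⊆ res B T) →
  All (CoveredBy B) A
res⊆⇒covered {A = A} {B} rA resA⊆resB = All.tabulate λ {a} a∈A x∈Pa →
  Any.map (λ {b} (enabled , x∈Pb) → (λ {y} → enabled-∁⇒⊆ a b enabled {y}) , x∈Pb)
    (∈-res⁻ B _ (resA⊆resB (∁ (I a))
      (∈-res⁺ A _ (Any.map (λ { refl → enabled-∁ a (All.lookup rA a∈A) , x∈Pa }) a∈A))))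

res≡⇔mutuallyCovered : ∀ {n} {A B : ReactionSystem n} → Reactantless A → Reactantless B →
  (∀ T → res A T ≡ res B T) ⇔ (All (CoveredBy B) A × All (CoveredBy A) B)
res≡⇔mutuallyCovered rA rB = mk⇔
  (λ res≡ → res⊆⇒covered rA (λ T → subst (_ ⊆_) (res≡ T) (λ x∈ → x∈))
          , res⊆⇒covered rB (λ T → subst (_⊆ _) (res≡ T) (λ x∈ → x∈)))
  (λ (covA , covB) T → ⊆-antisym (covered⇒res⊆ rB covA T) (covered⇒res⊆ rA covB T))

-- Finite types, used to number states and tape symbols

data Code : Set where
  one two : Code
  _⊕_ _⊗_ : Code → Code → Code

El : Code → Set
El one = ⊤
El two = Bool
El (a ⊕ b) = El a ⊎ El b
El (a ⊗ b) = El a × El b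

size : Code → ℕ
size one = 1
size two = 2
size (a ⊕ b) = size a + size b
size (a ⊗ b) = size a * size b

encode : ∀ a → El a → Fin (size a)
encode one _ = zero
encode two false = zero
encode two true = suc zero
encode (a ⊕ b) (inj₁ x) = encode a x ↑ˡ size b
encode (a ⊕ b) (inj₂ y) = size a ↑ʳ encode b y
encode (a ⊗ b) (x , y) = combine (encode a x) (encode b y)

decode : ∀ a → Fin (size a) → El a
decode one _ = tt
decode two zero = false
decode two (suc _) = true
decode (a ⊕ b) i = Sum.map (decode a) (decode b) (splitAt (size a) i)
decode (a ⊗ b) i = Prod.map (decode a) (decode b) (remQuot (size b) i)

decode-encode : ∀ a x → decode a (encode a x) ≡ x
decode-encode one tt = refl
decode-encode two false = refl
decode-encode two true = refl
decode-encode (a ⊕ b) (inj₁ x) rewrite splitAt-↑ˡ (size a) (encode a x) (size b) | decode-encode a x = refl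
decode-encode (a ⊕ b) (inj₂ y) rewrite splitAt-↑ʳ (size a) (size b) (encode b y) | decode-encode b y = refl
decode-encode (a ⊗ b) (x , y) =
  trans (cong (Prod.map (decode a) (decode b)) (remQuot-combine {size a} {size b} (encode a x) (encode b y)))
        (cong₂ _,_ (decode-encode a x) (decode-encode b y))

data Status : Set where
  fresh cur done : Status

-- v: value; cons: already handled in the current pass; cov: covered (for a guard bit: reached by
-- some current block); bad: a guard bit set in the current block but not here.
record Bit : Set where
  constructor bit
  field
    v cons cov bad : Bool
open Bit public

mkBit : Bool → Bit
mkBit x = bit x false false false

data WorkSymbol : Set where
  wH : Bool → WorkSymbol
  wL : Status → WorkSymbol
  wB : Bit → WorkSymbol

Cell : Set
Cell = Sym ⊎ WorkSymbol

data Token : Set where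
  tHdr : Bool → Token
  tHash : Token
  tLead : Status → Token
  tBit : Bit → Token

-- Where the head is in the layout 1ⁿ # A-blocks # B-blocks (each block 1 R I P #): in the header,
-- at the leading 1 of an A-/B-block, or among its bits. Input cells are parsed lazily by position.
data Pos : Set where
  PH PA0 PAb PB0 PBb : Pos

rawAt : Pos → Bool → Token
rawAt PH x = tHdr false
rawAt PA0 x = tLead fresh
rawAt PAb x = tBit (mkBit x)
rawAt PB0 x = tLead fresh
rawAt PBb x = tBit (mkBit x)

clsRaw : Pos → Sym → Token
clsRaw p b0 = rawAt p false
clsRaw p b1 = rawAt p true
clsRaw p hash = tHash

clsW : WorkSymbol → Token
clsW (wH u) = tHdr u
clsW (wL s) = tLead s
clsW (wB b) = tBit b

classify : Pos → Cell → Token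
classify p (inj₁ s) = clsRaw p s
classify p (inj₂ w) = clsW w

encAC : Token → Cell
encAC (tHdr u) = inj₂ (wH u)
encAC tHash = inj₁ hash
encAC (tLead s) = inj₂ (wL s)
encAC (tBit b) = inj₂ (wB b)

classify-encAC : ∀ p c → classify p (encAC c) ≡ c
classify-encAC p (tHdr x) = refl
classify-encAC p tHash = refl
classify-encAC p (tLead x) = refl
classify-encAC p (tBit x) = refl

hashPos : Pos → Pos
hashPos PH = PA0
hashPos PA0 = PB0
hashPos PAb = PA0
hashPos PB0 = PB0
hashPos PBb = PB0

nhPos : Pos → Pos
nhPos PH = PH
nhPos PA0 = PAb
nhPos PAb = PAb
nhPos PB0 = PBb
nhPos PBb = PBb

nextPos : Pos → Token → Pos
nextPos p tHash = hashPos p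
nextPos p (tHdr _) = nhPos p
nextPos p (tLead _) = nhPos p
nextPos p (tBit _) = nhPos p

region : Pos → Bool
region PH = false
region PA0 = false
region PAb = false
region PB0 = true
region PBb = true

data Mode : Set where
  mNext mRead mAct : Mode

data Fld : Set where
  fR fI fP : Fld

-- fld: field being processed; cb: bit carried from Read to Act; creg: side of the current block;
-- lst: last bit of the field; found/acc: Next has chosen a block / all set bits are covered so far;
-- inC/doneB: inside a block to be handled / its bit is handled; bbad: a guard violation was seen in
-- this block; hflip/jflip: the header counter has been advanced in this sweep / at the header
-- cell just passed.
record Regs : Set where
  constructor regs
  field
    fld : Fld
    cb creg lst found acc inC doneB bbad hflip jflip : Bool
open Regs public

parity : Fld → Bool
parity fR = false
parity fI = true
parity fP = false

isCur : Status → Bool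
isCur cur = true
isCur _ = false

-- In field f the header reads (¬ π)ʲ πᵐ with π = parity f; each Read sweep flips its first π.
-- The fields of a block alternate in parity, so the counter needs no reset between them;
-- Next sweeps clear it.
headerAct : Mode → Regs → Bool → Bool × Regs
headerAct mNext d u = false , d
headerAct mRead d u with hflip d
... | true = u , record d { jflip = false }
... | false = if u xor parity (fld d) then (u , d) else (not u , record d { hflip = true ; jflip = true })
headerAct mAct d u = u , d

hdrEnd : Mode → Regs → Regs
hdrEnd mRead d = record d { lst = jflip d }
hdrEnd _ d = d

hashEv : Mode → Pos → Regs → Regs
hashEv m PH d = hdrEnd m d
hashEv m _ d = d

nextLead : Bool → Regs → Status → Status × Regs
nextLead r d fresh = if found d then (fresh , d) else (cur , record d { found = true ; creg = r })
nextLead r d cur = done , d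
nextLead r d done = done , d

leaderAct : Mode → Bool → Regs → Status → Status × Regs
leaderAct mNext r d s = nextLead r d s
leaderAct mRead r d s = s , record d { inC = isCur s ; doneB = false }
leaderAct mAct r d s = s , record d { inC = r xor creg d ; doneB = false ; bbad = false }

actBit : Fld → Bool → Bool → Bit → Bit
actBit fP c bb b = record b { cons = true ; cov = cov b ∨ (not bb ∧ c) }
actBit _ c bb b = record b { cons = true ; cov = true ; bad = c ∧ not (v b) }

implies : Bool → Bool → Bool
implies false _ = true
implies true y = y

bitAct : Mode → Bool → Regs → Bit → Bit × Regs
bitAct mNext r d b = record b { cons = false ; bad = false } , record d { acc = acc d ∧ implies (v b) (cov b) }
bitAct mRead r d b = if inC d ∧ not (doneB d) ∧ not (cons b)
  then (record b { cons = true } , record d { cb = v b ; doneB = true })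
  else (b , d)
bitAct mAct r d b = if inC d ∧ not (doneB d) ∧ not (cons b)
  then (actBit (fld d) (cb d) (bbad d) b , record d { doneB = true ; bbad = bad b ∨ bbad d })
  else (b , record d { bbad = bad b ∨ bbad d })

tokenAct : Mode → Pos → Regs → Token → Token × Regs
tokenAct m p d tHash = tHash , hashEv m p d
tokenAct m p d (tHdr u) = tHdr (proj₁ (headerAct m d u)) , proj₂ (headerAct m d u)
tokenAct m p d (tLead s) = tLead (proj₁ (leaderAct m (region p) d s)) , proj₂ (leaderAct m (region p) d s)
tokenAct m p d (tBit b) = tBit (proj₁ (bitAct m (region p) d b)) , proj₂ (bitAct m (region p) d b)

nextInit : Regs
nextInit = regs fR false false false false true false false false false false

readInit : Fld → Bool → Regs
readInit f r = regs f false r false false true false false false false false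

actInit : Regs → Regs
actInit d = regs (fld d) (cb d) (creg d) (lst d) false true false false false false false

data End : Set where
  halt' : Bool → End
  next' : Mode → Regs → End

afterAct : Fld → Bool → End
afterAct fR r = next' mRead (readInit fI r)
afterAct fI r = next' mRead (readInit fP r)
afterAct fP r = next' mNext nextInit

endA : Mode → Regs → End
endA mNext d = if found d then next' mRead (readInit fR (creg d)) else halt' (acc d)
endA mRead d = next' mAct (actInit d)
endA mAct d = if lst d then afterAct (fld d) (creg d) else next' mRead (readInit (fld d) (creg d))

-- The abstract machine and its compilation into a Turing machine

-- sw: sweeping right through the tape; rt: returning to the blank left of it.
data St : Set where
  sw : Mode → Pos → Regs → St
  rt : Mode → Regs → St

CellA : Set
CellA = Maybe Cell

data ActA : Set where
  haltA : Bool → ActA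
  goA : St → CellA → Move → ActA

endAct : End → ActA
endAct (halt' b) = haltA b
endAct (next' m d) = goA (rt m d) nothing left

δA : St → CellA → ActA
δA (sw m p d) nothing = endAct (endA m d)
δA (sw m p d) (just x) =
  goA (sw m (nextPos p (classify p x)) (proj₂ (tokenAct m p d (classify p x))))
      (just (encAC (proj₁ (tokenAct m p d (classify p x))))) right
δA (rt m d) nothing = goA (sw m PH d) nothing right
δA (rt m d) (just x) = goA (rt m d) (just x) left

record ConfA : Set where
  constructor cA
  field
    s : St
    l : List CellA
    h : CellA
    r : List CellA

hd : List CellA → CellA
hd [] = nothing
hd (x ∷ _) = x

tl : List CellA → List CellA
tl [] = []
tl (_ ∷ xs) = xs

at : St → List CellA → List CellA → ConfA
at s L R = cA s L (hd R) (tl R)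

mvA : St → CellA → Move → List CellA → List CellA → ConfA
mvA s x left l r = cA s (tl l) (hd l) (x ∷ r)
mvA s x right l r = cA s (x ∷ l) (hd r) (tl r)
mvA s x stay l r = cA s l x r

data StepA : Set where
  stopped : Bool → StepA
  moved : ConfA → StepA

fromAct : ActA → List CellA → List CellA → StepA
fromAct (haltA b) l r = stopped b
fromAct (goA s x mv) l r = moved (mvA s x mv l r)

stepA : ConfA → StepA
stepA (cA s l h r) = fromAct (δA s h) l r

runA : ℕ → ConfA → Maybe Bool
contA : ℕ → StepA → Maybe Bool
runA zero c = nothing
runA (suc t) c = contA t (stepA c)
contA t (stopped b) = just b
contA t (moved c) = runA t c

three : Code
three = one ⊕ (one ⊕ one)

five : Code
five = one ⊕ (one ⊕ (one ⊕ (one ⊕ one)))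

toMode : Mode → El three
toMode mNext = inj₁ tt
toMode mRead = inj₂ (inj₁ tt)
toMode mAct = inj₂ (inj₂ tt)
fromMode : El three → Mode
fromMode (inj₁ _) = mNext
fromMode (inj₂ (inj₁ _)) = mRead
fromMode (inj₂ (inj₂ _)) = mAct
fromMode-toMode : ∀ m → fromMode (toMode m) ≡ m
fromMode-toMode mNext = refl
fromMode-toMode mRead = refl
fromMode-toMode mAct = refl

toFld : Fld → El three
toFld fR = inj₁ tt
toFld fI = inj₂ (inj₁ tt)
toFld fP = inj₂ (inj₂ tt)
fromFld : El three → Fld
fromFld (inj₁ _) = fR
fromFld (inj₂ (inj₁ _)) = fI
fromFld (inj₂ (inj₂ _)) = fP
fromFld-toFld : ∀ m → fromFld (toFld m) ≡ m
fromFld-toFld fR = refl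
fromFld-toFld fI = refl
fromFld-toFld fP = refl

toStatus : Status → El three
toStatus fresh = inj₁ tt
toStatus cur = inj₂ (inj₁ tt)
toStatus done = inj₂ (inj₂ tt)
fromStatus : El three → Status
fromStatus (inj₁ _) = fresh
fromStatus (inj₂ (inj₁ _)) = cur
fromStatus (inj₂ (inj₂ _)) = done
fromStatus-toStatus : ∀ m → fromStatus (toStatus m) ≡ m
fromStatus-toStatus fresh = refl
fromStatus-toStatus cur = refl
fromStatus-toStatus done = refl

toPos : Pos → El five
toPos PH = inj₁ tt
toPos PA0 = inj₂ (inj₁ tt)
toPos PAb = inj₂ (inj₂ (inj₁ tt))
toPos PB0 = inj₂ (inj₂ (inj₂ (inj₁ tt)))
toPos PBb = inj₂ (inj₂ (inj₂ (inj₂ tt)))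
fromPos : El five → Pos
fromPos (inj₁ _) = PH
fromPos (inj₂ (inj₁ _)) = PA0
fromPos (inj₂ (inj₂ (inj₁ _))) = PAb
fromPos (inj₂ (inj₂ (inj₂ (inj₁ _)))) = PB0
fromPos (inj₂ (inj₂ (inj₂ (inj₂ _)))) = PBb
fromPos-toPos : ∀ m → fromPos (toPos m) ≡ m
fromPos-toPos PH = refl
fromPos-toPos PA0 = refl
fromPos-toPos PAb = refl
fromPos-toPos PB0 = refl
fromPos-toPos PBb = refl

dC : Code
dC = three ⊗ (two ⊗ (two ⊗ (two ⊗ (two ⊗ (two ⊗ (two ⊗ (two ⊗ (two ⊗ (two ⊗ two)))))))))

toD : Regs → El dC
toD (regs f a b c e g h i j k l) = toFld f , a , b , c , e , g , h , i , j , k , l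
fromD : El dC → Regs
fromD (f , a , b , c , e , g , h , i , j , k , l) = regs (fromFld f) a b c e g h i j k l
fromD-toD : ∀ d → fromD (toD d) ≡ d
fromD-toD (regs f a b c e g h i j k l) rewrite fromFld-toFld f = refl

stC : Code
stC = (three ⊗ (five ⊗ dC)) ⊕ (three ⊗ dC)

toSt : St → El stC
toSt (sw m p d) = inj₁ (toMode m , toPos p , toD d)
toSt (rt m d) = inj₂ (toMode m , toD d)
fromSt : El stC → St
fromSt (inj₁ (m , p , d)) = sw (fromMode m) (fromPos p) (fromD d)
fromSt (inj₂ (m , d)) = rt (fromMode m) (fromD d)
fromSt-toSt : ∀ s → fromSt (toSt s) ≡ s
fromSt-toSt (sw m p d) rewrite fromMode-toMode m | fromPos-toPos p | fromD-toD d = refl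
fromSt-toSt (rt m d) rewrite fromMode-toMode m | fromD-toD d = refl

bitC : Code
bitC = two ⊗ (two ⊗ (two ⊗ two))

wsC : Code
wsC = two ⊕ (three ⊕ bitC)

toW : WorkSymbol → El wsC
toW (wH u) = inj₁ u
toW (wL s) = inj₂ (inj₁ (toStatus s))
toW (wB (bit a b c e)) = inj₂ (inj₂ (a , b , c , e))
fromW : El wsC → WorkSymbol
fromW (inj₁ u) = wH u
fromW (inj₂ (inj₁ s)) = wL (fromStatus s)
fromW (inj₂ (inj₂ (a , b , c , e))) = wB (bit a b c e)
fromW-toW : ∀ w → fromW (toW w) ≡ w
fromW-toW (wH u) = refl
fromW-toW (wL s) rewrite fromStatus-toStatus s = refl
fromW-toW (wB (bit a b c e)) = refl

K : ℕ
K = size wsC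

encCell : CellA → Γ K
encCell nothing = nothing
encCell (just (inj₁ s)) = just (inj₁ s)
encCell (just (inj₂ w)) = just (inj₂ (encode wsC (toW w)))

decCell : Γ K → CellA
decCell nothing = nothing
decCell (just (inj₁ s)) = just (inj₁ s)
decCell (just (inj₂ i)) = just (inj₂ (fromW (decode wsC i)))

decCell-encCell : ∀ c → decCell (encCell c) ≡ c
decCell-encCell nothing = refl
decCell-encCell (just (inj₁ x)) = refl
decCell-encCell (just (inj₂ w)) rewrite decode-encode wsC (toW w) | fromW-toW w = refl

encSt : St → Fin (size stC)
encSt s = encode stC (toSt s)

decSt : Fin (size stC) → St
decSt i = fromSt (decode stC i)

decSt-encSt : ∀ s → decSt (encSt s) ≡ s
decSt-encSt s rewrite decode-encode stC (toSt s) = fromSt-toSt s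

encAct : ActA → Action (size stC) K
encAct (haltA b) = halt b
encAct (goA s x m) = go (encSt s) (encCell x) m

startState : St
startState = sw mNext PH nextInit

M : TM
M = record { states = size stC ; extra = K ; start = encSt startState ;
             δ = λ q x → encAct (δA (decSt q) (decCell x)) }

encConf : ConfA → Config M
encConf (cA s l h r) = conf (encSt s) (map encCell l) (encCell h) (map encCell r)

encSR : StepA → StepResult M
encSR (stopped b) = halted b
encSR (moved c) = running (encConf c)

δ-enc : ∀ s x → TM.δ M (encSt s) (encCell x) ≡ encAct (δA s x)
δ-enc s x rewrite decSt-encSt s | decCell-encCell x = refl

stepFrom : Action (size stC) K → List (Γ K) → List (Γ K) → StepResult M
stepFrom (halt b) l r = halted b
stepFrom (go q x mv) l r = running (moveHead {M} q x mv l r)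

step-eq : ∀ q l h r → step M (conf q l h r) ≡ stepFrom (TM.δ M q h) l r
step-eq q l h r with TM.δ M q h
... | halt b = refl
... | go q' x mv = refl

mv-enc : ∀ s x mv l r → moveHead {M} (encSt s) (encCell x) mv (map encCell l) (map encCell r) ≡ encConf (mvA s x mv l r)
mv-enc s x left [] r = refl
mv-enc s x left (y ∷ l) r = refl
mv-enc s x right l [] = refl
mv-enc s x right l (y ∷ r) = refl
mv-enc s x stay l r = refl

step-encode : ∀ c → step M (encConf c) ≡ encSR (stepA c)
step-encode (cA s l h r) rewrite step-eq (encSt s) (map encCell l) (encCell h) (map encCell r) | δ-enc s h with δA s h
... | haltA b = refl
... | goA s' x mv = cong running (mv-enc s' x mv l r)

contM : ℕ → StepResult M → Maybe Bool
contM t (halted b) = just b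
contM t (running c) = run M t c

run-suc : ∀ t c → run M (suc t) c ≡ contM t (step M c)
run-suc t c with step M c
... | halted b = refl
... | running c' = refl

run-simulates : ∀ t c → run M t (encConf c) ≡ runA t c
run-simulates zero c = refl
run-simulates (suc t) c rewrite run-suc t (encConf c) | step-encode c with stepA c
... | stopped b = refl
... | moved c' = run-simulates t c'

initA : List Sym → ConfA
initA [] = cA startState [] nothing []
initA (x ∷ w) = cA startState [] (just (inj₁ x)) (map (λ y → just (inj₁ y)) w)

map-raw : ∀ (w : List Sym) → map encCell (map (λ y → just (inj₁ y)) w) ≡ map (λ y → just (inj₁ y)) w
map-raw [] = refl
map-raw (x ∷ w) = cong (_ ∷_) (map-raw w)

initConfig-encode : ∀ w → initConfig M w ≡ encConf (initA w)
initConfig-encode [] = refl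
initConfig-encode (x ∷ w) = cong (conf (encSt startState) [] (just (inj₁ x))) (sym (map-raw w))

SweepState : Set
SweepState = Pos × Regs

sweepStep : Mode → SweepState → Token → Token × SweepState
sweepStep m (p , d) c = proj₁ (tokenAct m p d c) , (nextPos p c , proj₂ (tokenAct m p d c))

scanOut : Mode → SweepState → List Token → List Token
scanOut m s [] = []
scanOut m s (c ∷ cs) = proj₁ (sweepStep m s c) ∷ scanOut m (proj₂ (sweepStep m s c)) cs

scanFin : Mode → SweepState → List Token → SweepState
scanFin m s [] = s
scanFin m s (c ∷ cs) = scanFin m (proj₂ (sweepStep m s c)) cs

clsAll : Pos → List Cell → List Token
clsAll p [] = []
clsAll p (x ∷ w) = classify p x ∷ clsAll (nextPos p (classify p x)) w

rapp : List CellA → List CellA → List CellA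
rapp [] ys = ys
rapp (x ∷ xs) ys = rapp xs (x ∷ ys)

run-rightSweep : ∀ m p d (cs : List Cell) L R t →
  runA (length cs + t) (at (sw m p d) L (map just cs ++ R)) ≡
  runA t (at (sw m (proj₁ (scanFin m (p , d) (clsAll p cs))) (proj₂ (scanFin m (p , d) (clsAll p cs))))
             (rapp (map just (map encAC (scanOut m (p , d) (clsAll p cs)))) L) R)
run-rightSweep m p d [] L R t = refl
run-rightSweep m p d (x ∷ cs) L R t = run-rightSweep m _ _ cs _ R t

run-return : ∀ m d (zs : List Cell) L R t →
  runA (length zs + t) (cA (rt m d) (tl (rapp (map just zs) L)) (hd (rapp (map just zs) L)) R) ≡
  runA t (cA (rt m d) (tl L) (hd L) (map just zs ++ R))
run-return m d [] L R t = refl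
run-return m d (z ∷ zs) L R t = trans (cong (λ k → runA k (cA (rt m d) (tl (rapp (map just zs) (just z ∷ L))) (hd (rapp (map just zs) (just z ∷ L))) R)) (sym (+-suc (length zs) t))) (run-return m d zs (just z ∷ L) R (suc t))

length-scanOut : ∀ m s cs → length (scanOut m s cs) ≡ length cs
length-scanOut m s [] = refl
length-scanOut m s (c ∷ cs) = cong suc (length-scanOut m _ cs)

length-clsAll : ∀ p cs → length (clsAll p cs) ≡ length cs
length-clsAll p [] = refl
length-clsAll p (c ∷ cs) = cong suc (length-clsAll _ cs)

sweepOut : Mode → Regs → List Cell → List Cell
sweepOut m d cs = map encAC (scanOut m (PH , d) (clsAll PH cs))

sweepFin : Mode → Regs → List Cell → Regs
sweepFin m d cs = proj₂ (scanFin m (PH , d) (clsAll PH cs))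

length-sweepOut : ∀ m d cs → length (sweepOut m d cs) ≡ length cs
length-sweepOut m d cs = trans (length-map encAC (scanOut m (PH , d) (clsAll PH cs))) (trans (length-scanOut m (PH , d) (clsAll PH cs)) (length-clsAll PH cs))

run-roundTrip : ∀ m d cs L R t m2 d2 → hd L ≡ nothing → hd R ≡ nothing →
  endA m (sweepFin m d cs) ≡ next' m2 d2 →
  runA (length cs + suc (length cs + suc t)) (at (sw m PH d) L (map just cs ++ R)) ≡
  runA t (at (sw m2 PH d2) (nothing ∷ tl L) (map just (sweepOut m d cs) ++ nothing ∷ tl R))
run-roundTrip m d cs L R t m2 d2 hL hR e
  rewrite run-rightSweep m PH d cs L R (suc (length cs + suc t)) | hR | e
        | sym (length-sweepOut m d cs)
        | run-return m2 d2 (sweepOut m d cs) L (nothing ∷ tl R) (suc t) | hL = refl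

run-lastSweep : ∀ m d cs L R t b → hd R ≡ nothing →
  endA m (sweepFin m d cs) ≡ halt' b →
  runA (length cs + suc t) (at (sw m PH d) L (map just cs ++ R)) ≡ just b
run-lastSweep m d cs L R t b hR e rewrite run-rightSweep m PH d cs L R (suc t) | hR | e = refl

record Block : Set where
  constructor block
  field
    st : Status
    q p : List Bit
open Block public

record Tape : Set where
  constructor tape
  field
    hdr : List Bool
    as bs : List Block
open Tape public

flatB : Block → List Token
flatB b = tLead (st b) ∷ (map tBit (q b ++ p b) ++ (tHash ∷ []))

flatBs : List Block → List Token
flatBs [] = []
flatBs (b ∷ bs) = flatB b ++ flatBs bs

flatT : Tape → List Token
flatT t = map tHdr (hdr t) ++ (tHash ∷ (flatBs (as t) ++ (tHash ∷ flatBs (bs t))))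

hdrOut : Mode → Regs → List Bool → List Bool
hdrOut m d [] = []
hdrOut m d (u ∷ us) = proj₁ (headerAct m d u) ∷ hdrOut m (proj₂ (headerAct m d u)) us

hdrFin : Mode → Regs → List Bool → Regs
hdrFin m d [] = d
hdrFin m d (u ∷ us) = hdrFin m (proj₂ (headerAct m d u)) us

bitsOut : Mode → Bool → Regs → List Bit → List Bit
bitsOut m r d [] = []
bitsOut m r d (b ∷ bs) = proj₁ (bitAct m r d b) ∷ bitsOut m r (proj₂ (bitAct m r d b)) bs

bitsFin : Mode → Bool → Regs → List Bit → Regs
bitsFin m r d [] = d
bitsFin m r d (b ∷ bs) = bitsFin m r (proj₂ (bitAct m r d b)) bs

blkOut : Mode → Bool → Regs → Block → Block
blkOut m r d b = block (proj₁ (leaderAct m r d (st b)))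
                     (bitsOut m r (proj₂ (leaderAct m r d (st b))) (q b))
                     (bitsOut m r (bitsFin m r (proj₂ (leaderAct m r d (st b))) (q b)) (p b))

blkFin : Mode → Bool → Regs → Block → Regs
blkFin m r d b = bitsFin m r (bitsFin m r (proj₂ (leaderAct m r d (st b))) (q b)) (p b)

blksOut : Mode → Bool → Regs → List Block → List Block
blksOut m r d [] = []
blksOut m r d (b ∷ bs) = blkOut m r d b ∷ blksOut m r (blkFin m r d b) bs

blksFin : Mode → Bool → Regs → List Block → Regs
blksFin m r d [] = d
blksFin m r d (b ∷ bs) = blksFin m r (blkFin m r d b) bs

dA : Mode → Regs → Tape → Regs
dA m d t = hdrEnd m (hdrFin m d (hdr t))

tOut : Mode → Regs → Tape → Tape
tOut m d t = tape (hdrOut m d (hdr t)) (blksOut m false (dA m d t) (as t))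
                 (blksOut m true (blksFin m false (dA m d t) (as t)) (bs t))

tFin : Mode → Regs → Tape → Regs
tFin m d t = blksFin m true (blksFin m false (dA m d t) (as t)) (bs t)

scanOut-++ : ∀ m s xs ys → scanOut m s (xs ++ ys) ≡ scanOut m s xs ++ scanOut m (scanFin m s xs) ys
scanOut-++ m s [] ys = refl
scanOut-++ m s (x ∷ xs) ys = cong (_ ∷_) (scanOut-++ m _ xs ys)

scanFin-++ : ∀ m s xs ys → scanFin m s (xs ++ ys) ≡ scanFin m (scanFin m s xs) ys
scanFin-++ m s [] ys = refl
scanFin-++ m s (x ∷ xs) ys = scanFin-++ m _ xs ys

hdr-out : ∀ m d us → scanOut m (PH , d) (map tHdr us) ≡ map tHdr (hdrOut m d us)
hdr-out m d [] = refl
hdr-out m d (u ∷ us) = cong (_ ∷_) (hdr-out m _ us)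

hdr-fin : ∀ m d us → scanFin m (PH , d) (map tHdr us) ≡ (PH , hdrFin m d us)
hdr-fin m d [] = refl
hdr-fin m d (u ∷ us) = hdr-fin m _ us

bitPos : Bool → Pos
bitPos false = PAb
bitPos true = PBb

startPos : Bool → Pos
startPos false = PA0
startPos true = PB0

bits-out : ∀ m r d bs → scanOut m (bitPos r , d) (map tBit bs) ≡ map tBit (bitsOut m r d bs)
bits-out m false d [] = refl
bits-out m false d (b ∷ bs) = cong (_ ∷_) (bits-out m false _ bs)
bits-out m true d [] = refl
bits-out m true d (b ∷ bs) = cong (_ ∷_) (bits-out m true _ bs)

bits-fin : ∀ m r d bs → scanFin m (bitPos r , d) (map tBit bs) ≡ (bitPos r , bitsFin m r d bs)
bits-fin m false d [] = refl
bits-fin m false d (b ∷ bs) = bits-fin m false _ bs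
bits-fin m true d [] = refl
bits-fin m true d (b ∷ bs) = bits-fin m true _ bs

reg-start : ∀ r → region (startPos r) ≡ r
reg-start false = refl
reg-start true = refl

nh-start : ∀ r → nhPos (startPos r) ≡ bitPos r
nh-start false = refl
nh-start true = refl

hash-pos : ∀ r → hashPos (bitPos r) ≡ startPos r
hash-pos false = refl
hash-pos true = refl

hash-ev : ∀ m r d → hashEv m (bitPos r) d ≡ d
hash-ev m false d = refl
hash-ev m true d = refl

blk-out : ∀ m r d b → scanOut m (startPos r , d) (flatB b) ≡ flatB (blkOut m r d b)
blk-out m r d (block s qs ps) rewrite reg-start r | nh-start r
  | map-++ tBit qs ps
  | scanOut-++ m (bitPos r , proj₂ (leaderAct m r d s)) (map tBit qs ++ map tBit ps) (tHash ∷ [])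
  | scanOut-++ m (bitPos r , proj₂ (leaderAct m r d s)) (map tBit qs) (map tBit ps)
  | bits-fin m r (proj₂ (leaderAct m r d s)) qs
  | bits-out m r (proj₂ (leaderAct m r d s)) qs
  | bits-out m r (bitsFin m r (proj₂ (leaderAct m r d s)) qs) ps
  | map-++ tBit (bitsOut m r (proj₂ (leaderAct m r d s)) qs) (bitsOut m r (bitsFin m r (proj₂ (leaderAct m r d s)) qs) ps)
  = refl

blk-fin : ∀ m r d b → scanFin m (startPos r , d) (flatB b) ≡ (startPos r , blkFin m r d b)
blk-fin m r d (block s qs ps) rewrite reg-start r | nh-start r
  | map-++ tBit qs ps
  | scanFin-++ m (bitPos r , proj₂ (leaderAct m r d s)) (map tBit qs ++ map tBit ps) (tHash ∷ [])
  | scanFin-++ m (bitPos r , proj₂ (leaderAct m r d s)) (map tBit qs) (map tBit ps)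
  | bits-fin m r (proj₂ (leaderAct m r d s)) qs
  | bits-fin m r (bitsFin m r (proj₂ (leaderAct m r d s)) qs) ps
  | hash-pos r | hash-ev m r (bitsFin m r (bitsFin m r (proj₂ (leaderAct m r d s)) qs) ps)
  = refl

blks-out : ∀ m r d bs → scanOut m (startPos r , d) (flatBs bs) ≡ flatBs (blksOut m r d bs)
blks-out m r d [] = refl
blks-out m r d (b ∷ bs) = trans (scanOut-++ m (startPos r , d) (flatB b) (flatBs bs))
  (cong₂ _++_ (blk-out m r d b) (trans (cong (λ s → scanOut m s (flatBs bs)) (blk-fin m r d b)) (blks-out m r (blkFin m r d b) bs)))

blks-fin : ∀ m r d bs → scanFin m (startPos r , d) (flatBs bs) ≡ (startPos r , blksFin m r d bs)
blks-fin m r d [] = refl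
blks-fin m r d (b ∷ bs) = trans (scanFin-++ m (startPos r , d) (flatB b) (flatBs bs))
  (trans (cong (λ s → scanFin m s (flatBs bs)) (blk-fin m r d b)) (blks-fin m r (blkFin m r d b) bs))

t-out : ∀ m d t → scanOut m (PH , d) (flatT t) ≡ flatT (tOut m d t)
t-out m d (tape h as bs) rewrite scanOut-++ m (PH , d) (map tHdr h) (tHash ∷ (flatBs as ++ (tHash ∷ flatBs bs)))
  | hdr-out m d h | hdr-fin m d h
  | scanOut-++ m (PA0 , hdrEnd m (hdrFin m d h)) (flatBs as) (tHash ∷ flatBs bs)
  | blks-out m false (hdrEnd m (hdrFin m d h)) as
  | blks-fin m false (hdrEnd m (hdrFin m d h)) as
  | blks-out m true (blksFin m false (hdrEnd m (hdrFin m d h)) as) bs = refl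

t-fin : ∀ m d t → proj₂ (scanFin m (PH , d) (flatT t)) ≡ tFin m d t
t-fin m d (tape h as bs) rewrite scanFin-++ m (PH , d) (map tHdr h) (tHash ∷ (flatBs as ++ (tHash ∷ flatBs bs)))
  | hdr-fin m d h
  | scanFin-++ m (PA0 , hdrEnd m (hdrFin m d h)) (flatBs as) (tHash ∷ flatBs bs)
  | blks-fin m false (hdrEnd m (hdrFin m d h)) as
  | blks-fin m true (blksFin m false (hdrEnd m (hdrFin m d h)) as) bs = refl

clsAll-enc : ∀ p cs → clsAll p (map encAC cs) ≡ cs
clsAll-enc p [] = refl
clsAll-enc p (c ∷ cs) rewrite classify-encAC p c = cong (c ∷_) (clsAll-enc _ cs)

cellsT : Tape → List Cell
cellsT t = map encAC (flatT t)

-- Macro-steps: a sweep followed by the return of the head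

record MacroConfig : Set where
  constructor config
  field
    md : Mode
    dd : Regs
    tp : Tape
open MacroConfig public

macroEnd : MacroConfig → End
macroEnd c = endA (md c) (tFin (md c) (dd c) (tp c))

macroTape : MacroConfig → Tape
macroTape c = tOut (md c) (dd c) (tp c)

macroSteps : ℕ → MacroConfig → Maybe MacroConfig
macroStepsFrom : ℕ → End → Tape → Maybe MacroConfig
macroSteps zero c = just c
macroSteps (suc k) c = macroStepsFrom k (macroEnd c) (macroTape c)
macroStepsFrom k (halt' b) t = nothing
macroStepsFrom k (next' m d) t = macroSteps k (config m d t)

roundTrip : ℕ → ℕ
roundTrip L = suc (suc (L + L))

roundTrip-split : ∀ L Y → roundTrip L + Y ≡ L + suc (L + suc Y)
roundTrip-split = solve 2 (λ L Y → (con 2 :+ (L :+ L)) :+ Y := L :+ (con 1 :+ (L :+ (con 1 :+ Y)))) refl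

Represents : List Cell → Tape → Set
Represents cs t = clsAll PH cs ≡ flatT t

run-macroSteps : ∀ k t m d c' b cs Lb Rb f → Represents cs t → hd Lb ≡ nothing → hd Rb ≡ nothing →
  macroSteps k (config m d t) ≡ just c' → macroEnd c' ≡ halt' b →
  runA (k * roundTrip (length cs) + (length cs + suc f)) (at (sw m PH d) Lb (map just cs ++ Rb)) ≡ just b
run-macroSteps zero t m d .(config m d t) b cs Lb Rb f rep hL hR refl e =
  run-lastSweep m d cs Lb Rb f b hR (trans (cong (λ z → endA m (proj₂ (scanFin m (PH , d) z))) rep) (trans (cong (endA m) (t-fin m d t)) e))
run-macroSteps (suc k) t m d c' b cs Lb Rb f rep hL hR it e with endA m (tFin m d t) in eqE
... | next' m2 d2 =
  let L = length cs
      cs' = sweepOut m d cs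
      eqO : cs' ≡ cellsT (tOut m d t)
      eqO = trans (cong (λ z → map encAC (scanOut m (PH , d) z)) rep) (cong (map encAC) (t-out m d t))
      eqL : length cs' ≡ L
      eqL = length-sweepOut m d cs
      eF : endA m (sweepFin m d cs) ≡ next' m2 d2
      eF = trans (cong (λ z → endA m (proj₂ (scanFin m (PH , d) z))) rep) (trans (cong (endA m) (t-fin m d t)) eqE)
      rep' : Represents cs' (tOut m d t)
      rep' = trans (cong (clsAll PH) eqO) (clsAll-enc PH (flatT (tOut m d t)))
      ih = run-macroSteps k (tOut m d t) m2 d2 c' b cs' (nothing ∷ tl Lb) (nothing ∷ tl Rb) f rep' refl refl it e
      ih' : runA (k * roundTrip L + (L + suc f)) (at (sw m2 PH d2) (nothing ∷ tl Lb) (map just cs' ++ nothing ∷ tl Rb)) ≡ just b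
      ih' = subst (λ z → runA (k * roundTrip z + (z + suc f)) (at (sw m2 PH d2) (nothing ∷ tl Lb) (map just cs' ++ nothing ∷ tl Rb)) ≡ just b) eqL ih
  in trans (cong (λ z → runA z (at (sw m PH d) Lb (map just cs ++ Rb)))
                 (trans (+-assoc (roundTrip L) (k * roundTrip L) (L + suc f)) (roundTrip-split L (k * roundTrip L + (L + suc f)))))
           (trans (run-roundTrip m d cs Lb Rb (k * roundTrip L + (L + suc f)) m2 d2 hL hR eF) ih')

-- A bit of a block between passes: its value and whether it is covered.
BitPair : Set
BitPair = Bool × Bool

bitOf : BitPair → Bit
bitOf x = bit (proj₁ x) false (proj₂ x) false

markFirst : ℕ → List Bit → List Bit
markFirst zero bs = bs
markFirst (suc k) [] = []
markFirst (suc k) (b ∷ bs) = record b { cons = true } ∷ markFirst k bs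

nthValue : ℕ → List BitPair → Bool
nthValue _ [] = false
nthValue zero (x ∷ _) = proj₁ x
nthValue (suc k) (_ ∷ xs) = nthValue k xs

procQ : Bool → Bit → Bit
procQ c b = record b { cons = true ; cov = true ; bad = c ∧ not (v b) }

procP : Bool → Bool → Bit → Bit
procP ok c b = record b { cons = true ; cov = cov b ∨ (ok ∧ c) }

actOnGuards : ℕ → List BitPair → List Bit → List Bit
actOnGuards zero cs bs = bs
actOnGuards (suc k) [] bs = bs
actOnGuards (suc k) (c ∷ cs) [] = []
actOnGuards (suc k) (c ∷ cs) (b ∷ bs) = procQ (proj₁ c) b ∷ actOnGuards k cs bs

actOnProducts : Bool → ℕ → List BitPair → List Bit → List Bit
actOnProducts ok zero cs bs = bs
actOnProducts ok (suc k) [] bs = bs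
actOnProducts ok (suc k) (c ∷ cs) [] = []
actOnProducts ok (suc k) (c ∷ cs) (b ∷ bs) = procP ok (proj₁ c) b ∷ actOnProducts ok k cs bs

okQ : List BitPair → List BitPair → Bool
okQ [] _ = true
okQ (c ∷ cs) [] = true
okQ (c ∷ cs) (t ∷ ts) = implies (proj₁ c) (proj₁ t) ∧ okQ cs ts

record BlockData : Set where
  constructor blockData
  field
    sq sp : List BitPair
open BlockData public

currentBlock : ℕ → ℕ → BlockData → Block
currentBlock kq kp c = block cur (markFirst kq (map bitOf (sq c))) (markFirst kp (map bitOf (sp c)))

rdD : Bool → Bool → Regs → Regs
rdD i b d = record d { inC = i ; doneB = b }

R-off : ∀ r d bs → bitsOut mRead r (rdD false false d) bs ≡ bs × bitsFin mRead r (rdD false false d) bs ≡ rdD false false d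
R-off r d [] = refl , refl
R-off r d (b ∷ bs) with R-off r d bs
... | e1 , e2 = cong (b ∷_) e1 , e2

R-done : ∀ r d bs → bitsOut mRead r (rdD true true d) bs ≡ bs × bitsFin mRead r (rdD true true d) bs ≡ rdD true true d
R-done r d [] = refl , refl
R-done r d (b ∷ bs) with R-done r d bs
... | e1 , e2 = cong (b ∷_) e1 , e2

R-all : ∀ r d xs →
  bitsOut mRead r (rdD true false d) (markFirst (length xs) (map bitOf xs)) ≡ markFirst (length xs) (map bitOf xs) ×
  bitsFin mRead r (rdD true false d) (markFirst (length xs) (map bitOf xs)) ≡ rdD true false d
R-all r d [] = refl , refl
R-all r d (x ∷ xs) with R-all r d xs
... | e1 , e2 = cong (_ ∷_) e1 , e2

R-one : ∀ r d k xs → k < length xs →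
  bitsOut mRead r (rdD true false d) (markFirst k (map bitOf xs)) ≡ markFirst (suc k) (map bitOf xs) ×
  bitsFin mRead r (rdD true false d) (markFirst k (map bitOf xs)) ≡ rdD true true (record d { cb = nthValue k xs })
R-one r d zero (x ∷ xs) lt =
  cong (_ ∷_) (proj₁ (R-done r (record d { cb = proj₁ x }) (map bitOf xs))) , proj₂ (R-done r (record d { cb = proj₁ x }) (map bitOf xs))
R-one r d (suc k) (x ∷ xs) (s≤s lt) with R-one r d k xs lt
... | e1 , e2 = cong (_ ∷_) e1 , e2

rD : Fld → Bool → Bool → Bool → Bool → Bool → Bool → Bool → Regs
rD f c cr l i db hf jf = regs f c cr l false true i db false hf jf

aD : Fld → Bool → Bool → Bool → Bool → Bool → Bool → Regs
aD f c cr l i db bb = regs f c cr l false true i db bb false false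

nD : Bool → Bool → Bool → Regs
nD cr fo ac = regs fR false cr false fo ac false false false false false

toBs : Status → BlockData → Block
toBs s b = block s (map bitOf (sq b)) (map bitOf (sp b))

NotCurrent : Block → Set
NotCurrent b = isCur (st b) ≡ false

blkEq : ∀ m r d s qs ps s' qs' ps' d2 d3 → proj₁ (leaderAct m r d s) ≡ s' →
  bitsOut m r (proj₂ (leaderAct m r d s)) qs ≡ qs' → bitsFin m r (proj₂ (leaderAct m r d s)) qs ≡ d2 →
  bitsOut m r d2 ps ≡ ps' → bitsFin m r d2 ps ≡ d3 →
  blkOut m r d (block s qs ps) ≡ block s' qs' ps' × blkFin m r d (block s qs ps) ≡ d3
blkEq m r d s qs ps s' qs' ps' d2 d3 e0 e1 e2 e3 e4 =
  trans (cong₂ (λ a b → block a b (bitsOut m r (bitsFin m r (proj₂ (leaderAct m r d s)) qs) ps)) e0 e1)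
        (cong (block s' qs') (trans (cong (λ z → bitsOut m r z ps) e2) e3)) ,
  trans (cong (λ z → bitsFin m r z ps) e2) e4

RB-non : ∀ r f c cr l i db hf jf b → NotCurrent b →
  blkOut mRead r (rD f c cr l i db hf jf) b ≡ b × blkFin mRead r (rD f c cr l i db hf jf) b ≡ rD f c cr l false false hf jf
RB-non r f c cr l i db hf jf (block fresh qs ps) nc =
  blkEq mRead r (rD f c cr l i db hf jf) fresh qs ps fresh qs ps _ _ refl
    (proj₁ (R-off r (rD f c cr l i db hf jf) qs)) (proj₂ (R-off r (rD f c cr l i db hf jf) qs))
    (proj₁ (R-off r (rD f c cr l i db hf jf) ps)) (proj₂ (R-off r (rD f c cr l i db hf jf) ps))
RB-non r f c cr l i db hf jf (block done qs ps) nc =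
  blkEq mRead r (rD f c cr l i db hf jf) done qs ps done qs ps _ _ refl
    (proj₁ (R-off r (rD f c cr l i db hf jf) qs)) (proj₂ (R-off r (rD f c cr l i db hf jf) qs))
    (proj₁ (R-off r (rD f c cr l i db hf jf) ps)) (proj₂ (R-off r (rD f c cr l i db hf jf) ps))

RBs-non : ∀ r f c cr l i db hf jf bs → All NotCurrent bs →
  blksOut mRead r (rD f c cr l i db hf jf) bs ≡ bs × ∃₂ λ i' db' → blksFin mRead r (rD f c cr l i db hf jf) bs ≡ rD f c cr l i' db' hf jf
RBs-non r f c cr l i db hf jf [] [] = refl , i , db , refl
RBs-non r f c cr l i db hf jf (b ∷ bs) (nc ∷ ncs) with RBs-non r f c cr l false false hf jf bs ncs
... | e1 , i' , db' , e2 =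
  cong₂ _∷_ (proj₁ (RB-non r f c cr l i db hf jf b nc))
    (trans (cong (λ z → blksOut mRead r z bs) (proj₂ (RB-non r f c cr l i db hf jf b nc))) e1) ,
  i' , db' , trans (cong (λ z → blksFin mRead r z bs) (proj₂ (RB-non r f c cr l i db hf jf b nc))) e2

RB-curQ : ∀ r f c0 cr l i db hf jf kq c → kq < length (sq c) →
  blkOut mRead r (rD f c0 cr l i db hf jf) (currentBlock kq 0 c) ≡ currentBlock (suc kq) 0 c ×
  blkFin mRead r (rD f c0 cr l i db hf jf) (currentBlock kq 0 c) ≡ rD f (nthValue kq (sq c)) cr l true true hf jf
RB-curQ r f c0 cr l i db hf jf kq (blockData qs ps) lt =
  blkEq mRead r (rD f c0 cr l i db hf jf) cur _ _ cur _ _ _ _ refl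
    (proj₁ (R-one r (rD f c0 cr l i db hf jf) kq qs lt)) (proj₂ (R-one r (rD f c0 cr l i db hf jf) kq qs lt))
    (proj₁ (R-done r (rD f (nthValue kq qs) cr l i db hf jf) (map bitOf ps)))
    (proj₂ (R-done r (rD f (nthValue kq qs) cr l i db hf jf) (map bitOf ps)))

RB-curP : ∀ r f c0 cr l i db hf jf kp c → kp < length (sp c) →
  blkOut mRead r (rD f c0 cr l i db hf jf) (currentBlock (length (sq c)) kp c) ≡ currentBlock (length (sq c)) (suc kp) c ×
  blkFin mRead r (rD f c0 cr l i db hf jf) (currentBlock (length (sq c)) kp c) ≡ rD f (nthValue kp (sp c)) cr l true true hf jf
RB-curP r f c0 cr l i db hf jf kp (blockData qs ps) lt =
  blkEq mRead r (rD f c0 cr l i db hf jf) cur _ _ cur _ _ _ _ refl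
    (proj₁ (R-all r (rD f c0 cr l i db hf jf) qs)) (proj₂ (R-all r (rD f c0 cr l i db hf jf) qs))
    (proj₁ (R-one r (rD f c0 cr l i db hf jf) kp ps lt)) (proj₂ (R-one r (rD f c0 cr l i db hf jf) kp ps lt))

accBad : Bool → List Bit → Bool
accBad bb [] = bb
accBad bb (b ∷ bs) = accBad (bad b ∨ bb) bs

A-off : ∀ r f c cr l db bb bs →
  bitsOut mAct r (aD f c cr l false db bb) bs ≡ bs × bitsFin mAct r (aD f c cr l false db bb) bs ≡ aD f c cr l false db (accBad bb bs)
A-off r f c cr l db bb [] = refl , refl
A-off r f c cr l db bb (b ∷ bs) with A-off r f c cr l db (bad b ∨ bb) bs
... | e1 , e2 = cong (b ∷_) e1 , e2

A-done : ∀ r f c cr l bb bs →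
  bitsOut mAct r (aD f c cr l true true bb) bs ≡ bs × bitsFin mAct r (aD f c cr l true true bb) bs ≡ aD f c cr l true true (accBad bb bs)
A-done r f c cr l bb [] = refl , refl
A-done r f c cr l bb (b ∷ bs) with A-done r f c cr l (bad b ∨ bb) bs
... | e1 , e2 = cong (b ∷_) e1 , e2

A-Q : ∀ r f cr l bb k cs ts → (∀ c bb b → actBit f c bb b ≡ procQ c b) → k < length cs → k < length ts →
  bitsOut mAct r (aD f (nthValue k cs) cr l true false bb) (actOnGuards k cs (map bitOf ts)) ≡ actOnGuards (suc k) cs (map bitOf ts) ×
  ∃ λ bb' → bitsFin mAct r (aD f (nthValue k cs) cr l true false bb) (actOnGuards k cs (map bitOf ts)) ≡ aD f (nthValue k cs) cr l true true bb'
A-Q r f cr l bb zero (c ∷ cs) (t ∷ ts) P lt1 lt2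
  rewrite P (proj₁ c) bb (bitOf t)
        | proj₁ (A-done r f (proj₁ c) cr l (bad (bitOf t) ∨ bb) (map bitOf ts))
        | proj₂ (A-done r f (proj₁ c) cr l (bad (bitOf t) ∨ bb) (map bitOf ts)) = refl , _ , refl
A-Q r f cr l bb (suc k) (c ∷ cs) (t ∷ ts) P (s≤s lt1) (s≤s lt2)
  with A-Q r f cr l (bad (procQ (proj₁ c) (bitOf t)) ∨ bb) k cs ts P lt1 lt2
... | e1 , bb' , e2 = cong (_ ∷_) e1 , bb' , e2

A-zqfull : ∀ r f c cr l bb cs ts → length cs ≡ length ts →
  bitsOut mAct r (aD f c cr l true false bb) (actOnGuards (length cs) cs (map bitOf ts)) ≡ actOnGuards (length cs) cs (map bitOf ts) ×
  bitsFin mAct r (aD f c cr l true false bb) (actOnGuards (length cs) cs (map bitOf ts)) ≡ aD f c cr l true false (accBad bb (actOnGuards (length cs) cs (map bitOf ts)))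
A-zqfull r f c cr l bb [] [] e = refl , refl
A-zqfull r f c cr l bb (x ∷ cs) (t ∷ ts) e with A-zqfull r f c cr l (bad (procQ (proj₁ x) (bitOf t)) ∨ bb) cs ts (cong pred e)
... | e1 , e2 = cong (_ ∷_) e1 , e2

A-P : ∀ r cr l bb ok k cs ts → not bb ≡ ok → k < length cs → k < length ts →
  bitsOut mAct r (aD fP (nthValue k cs) cr l true false bb) (actOnProducts ok k cs (map bitOf ts)) ≡ actOnProducts ok (suc k) cs (map bitOf ts)
A-P r cr l bb ok zero (c ∷ cs) (t ∷ ts) e lt1 lt2 =
  cong₂ _∷_ (cong (λ z → bit (proj₁ t) true (proj₂ t ∨ (z ∧ proj₁ c)) false) e)
            (proj₁ (A-done r fP (proj₁ c) cr l (false ∨ bb) (map bitOf ts)))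
A-P r cr l bb ok (suc k) (c ∷ cs) (t ∷ ts) e (s≤s lt1) (s≤s lt2) =
  cong (_ ∷_) (A-P r cr l bb ok k cs ts e lt1 lt2)

notimp : ∀ c t o bb → (c ∧ not t) ∨ (not o ∨ bb) ≡ not (implies c t ∧ o) ∨ bb
notimp false t o bb = refl
notimp true false o bb = refl
notimp true true o bb = refl

accBad-zq : ∀ bb cs ts → length cs ≡ length ts → accBad bb (actOnGuards (length cs) cs (map bitOf ts)) ≡ not (okQ cs ts) ∨ bb
accBad-zq bb [] [] e = refl
accBad-zq bb (c ∷ cs) (t ∷ ts) e = trans (accBad-zq (bad (procQ (proj₁ c) (bitOf t)) ∨ bb) cs ts (cong pred e))
  (trans (∨-swap (not (okQ cs ts)) (proj₁ c ∧ not (proj₁ t)) bb) (notimp (proj₁ c) (proj₁ t) (okQ cs ts) bb))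
  where
  ∨-swap : ∀ x y z → x ∨ (y ∨ z) ≡ y ∨ (x ∨ z)
  ∨-swap false y z = refl
  ∨-swap true false z = refl
  ∨-swap true true z = refl

notnot : ∀ o → not (not o ∨ false) ≡ o
notnot false = refl
notnot true = refl

targetBlock : Status → BlockData → ℕ → ℕ → BlockData → Block
targetBlock s c kq kp t = block s (actOnGuards kq (sq c) (map bitOf (sq t))) (actOnProducts (okQ (sq c) (sq t)) kp (sp c) (map bitOf (sp t)))

AB-off : ∀ r f c cr l i db bb b → (r xor cr) ≡ false →
  blkOut mAct r (aD f c cr l i db bb) b ≡ b × ∃ λ bb' → blkFin mAct r (aD f c cr l i db bb) b ≡ aD f c cr l false false bb'
AB-off r f c cr l i db bb (block s qs ps) e rewrite e
  | proj₁ (A-off r f c cr l false false qs) | proj₂ (A-off r f c cr l false false qs)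
  | proj₁ (A-off r f c cr l false (accBad false qs) ps) | proj₂ (A-off r f c cr l false (accBad false qs) ps) = refl , _ , refl

ABs-off : ∀ r f c cr l i db bb bs → (r xor cr) ≡ false →
  blksOut mAct r (aD f c cr l i db bb) bs ≡ bs × ∃₂ λ i' db' → ∃ λ bb' → blksFin mAct r (aD f c cr l i db bb) bs ≡ aD f c cr l i' db' bb'
ABs-off r f c cr l i db bb [] e = refl , i , db , bb , refl
ABs-off r f c cr l i db bb (b ∷ bs) e with AB-off r f c cr l i db bb b e
... | e1 , bb1 , e2 rewrite e1 | e2 with ABs-off r f c cr l false false bb1 bs e
... | e3 , i' , db' , bb' , e4 = cong (b ∷_) e3 , i' , db' , bb' , e4

AB-Q : ∀ r f cr l i db bb s kq c t → (r xor cr) ≡ true → (∀ c bb b → actBit f c bb b ≡ procQ c b) →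
  kq < length (sq c) → kq < length (sq t) →
  blkOut mAct r (aD f (nthValue kq (sq c)) cr l i db bb) (targetBlock s c kq 0 t) ≡ targetBlock s c (suc kq) 0 t
AB-Q r f cr l i db bb s kq c t e P lt1 lt2 rewrite e
  with A-Q r f cr l false kq (sq c) (sq t) P lt1 lt2
... | e1 , bb' , e2 rewrite e1 | e2 | proj₁ (A-done r f (nthValue kq (sq c)) cr l bb' (map bitOf (sp t))) = refl

AB-P : ∀ r cr l i db bb s kp c t → (r xor cr) ≡ true →
  length (sq c) ≡ length (sq t) → kp < length (sp c) → kp < length (sp t) →
  blkOut mAct r (aD fP (nthValue kp (sp c)) cr l i db bb) (targetBlock s c (length (sq c)) kp t) ≡ targetBlock s c (length (sq c)) (suc kp) t
AB-P r cr l i db bb s kp c t e eq lt1 lt2 rewrite e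
  | proj₁ (A-zqfull r fP (nthValue kp (sp c)) cr l false (sq c) (sq t) eq)
  | proj₂ (A-zqfull r fP (nthValue kp (sp c)) cr l false (sq c) (sq t) eq)
  | A-P r cr l (accBad false (actOnGuards (length (sq c)) (sq c) (map bitOf (sq t)))) (okQ (sq c) (sq t)) kp (sp c) (sp t)
        (trans (cong not (accBad-zq false (sq c) (sq t) eq)) (notnot (okQ (sq c) (sq t)))) lt1 lt2 = refl

A-fin-bits : ∀ r f c cr l i db bb bs → ∃₂ λ db' bb' → bitsFin mAct r (aD f c cr l i db bb) bs ≡ aD f c cr l i db' bb'
A-fin-bits r f c cr l i db bb [] = db , bb , refl
A-fin-bits r f c cr l i db bb (b ∷ bs) with i ∧ not db ∧ not (cons b)
... | true = A-fin-bits r f c cr l i true (bad b ∨ bb) bs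
... | false = A-fin-bits r f c cr l i db (bad b ∨ bb) bs

A-fin-blk : ∀ r f c cr l i db bb b → ∃₂ λ i' db' → ∃ λ bb' → blkFin mAct r (aD f c cr l i db bb) b ≡ aD f c cr l i' db' bb'
A-fin-blk r f c cr l i db bb (block s qs ps) with A-fin-bits r f c cr l (r xor cr) false false qs
... | db1 , bb1 , e1 with A-fin-bits r f c cr l (r xor cr) db1 bb1 ps
... | db2 , bb2 , e2 = r xor cr , db2 , bb2 , trans (cong (λ z → bitsFin mAct r z ps) e1) e2

A-fin-blks : ∀ r f c cr l i db bb bs → ∃₂ λ i' db' → ∃ λ bb' → blksFin mAct r (aD f c cr l i db bb) bs ≡ aD f c cr l i' db' bb'
A-fin-blks r f c cr l i db bb [] = i , db , bb , refl
A-fin-blks r f c cr l i db bb (b ∷ bs) with A-fin-blk r f c cr l i db bb b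
... | i1 , db1 , bb1 , e1 with A-fin-blks r f c cr l i1 db1 bb1 bs
... | i2 , db2 , bb2 , e2 = i2 , db2 , bb2 , trans (cong (λ z → blksFin mAct r z bs) e1) e2

ABs-map : ∀ r f c cr l (g g' : BlockData → Block) ts →
  (∀ i db bb t → blkOut mAct r (aD f c cr l i db bb) (g t) ≡ g' t) →
  ∀ i db bb → blksOut mAct r (aD f c cr l i db bb) (map g ts) ≡ map g' ts
ABs-map r f c cr l g g' [] H i db bb = refl
ABs-map r f c cr l g g' (t ∷ ts) H i db bb with A-fin-blk r f c cr l i db bb (g t)
... | i1 , db1 , bb1 , e1 =
  cong₂ _∷_ (H i db bb t) (trans (cong (λ z → blksOut mAct r z (map g ts)) e1) (ABs-map r f c cr l g g' ts H i1 db1 bb1))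

ABs-mapA : ∀ r f c cr l (P : BlockData → Set) (g g' : BlockData → Block) ts → All P ts →
  (∀ i db bb t → P t → blkOut mAct r (aD f c cr l i db bb) (g t) ≡ g' t) →
  ∀ i db bb → blksOut mAct r (aD f c cr l i db bb) (map g ts) ≡ map g' ts
ABs-mapA r f c cr l P g g' [] [] H i db bb = refl
ABs-mapA r f c cr l P g g' (t ∷ ts) (pt ∷ pts) H i db bb with A-fin-blk r f c cr l i db bb (g t)
... | i1 , db1 , bb1 , e1 =
  cong₂ _∷_ (H i db bb t pt) (trans (cong (λ z → blksOut mAct r z (map g ts)) e1) (ABs-mapA r f c cr l P g g' ts pts H i1 db1 bb1))

counterHeader : Bool → ℕ → ℕ → List Bool
counterHeader π j m = replicate j (not π) ++ replicate m π

isZero : ℕ → Bool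
isZero zero = true
isZero (suc _) = false

hA1 : ∀ d u → hflip d ≡ false → u xor parity (fld d) ≡ true → headerAct mRead d u ≡ (u , d)
hA1 d u e1 e2 with hflip d
hA1 d u refl e2 | false rewrite e2 = refl

hA2 : ∀ d u → hflip d ≡ false → u xor parity (fld d) ≡ false → headerAct mRead d u ≡ (not u , record d { hflip = true ; jflip = true })
hA2 d u e1 e2 with hflip d
hA2 d u refl e2 | false rewrite e2 = refl

Hpre : ∀ d j rest → hflip d ≡ false → not (parity (fld d)) xor parity (fld d) ≡ true →
  hdrOut mRead d (replicate j (not (parity (fld d))) ++ rest) ≡ replicate j (not (parity (fld d))) ++ hdrOut mRead d rest ×
  hdrFin mRead d (replicate j (not (parity (fld d))) ++ rest) ≡ hdrFin mRead d rest
Hpre d zero rest e1 e2 = refl , refl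
Hpre d (suc j) rest e1 e2 rewrite hA1 d (not (parity (fld d))) e1 e2 with Hpre d j rest e1 e2
... | x , y = cong (_ ∷_) x , y

Hpost0 : ∀ f c cr l us → hdrOut mRead (rD f c cr l false false true false) us ≡ us ×
  hdrFin mRead (rD f c cr l false false true false) us ≡ rD f c cr l false false true false
Hpost0 f c cr l [] = refl , refl
Hpost0 f c cr l (u ∷ us) with Hpost0 f c cr l us
... | x , y = cong (u ∷_) x , y

Hpost : ∀ f c cr l u m → hdrOut mRead (rD f c cr l false false true true) (replicate m u) ≡ replicate m u ×
  hdrFin mRead (rD f c cr l false false true true) (replicate m u) ≡ rD f c cr l false false true (isZero m)
Hpost f c cr l u zero = refl , refl
Hpost f c cr l u (suc m) with Hpost0 f c cr l (replicate m u)
... | x , y = cong (u ∷_) x , y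

xor1 : ∀ f → not (parity f) xor parity f ≡ true
xor1 fR = refl
xor1 fI = refl
xor1 fP = refl

xor2 : ∀ f → parity f xor parity f ≡ false
xor2 fR = refl
xor2 fI = refl
xor2 fP = refl

rep-snoc : ∀ {A : Set} j (x : A) ys → replicate j x ++ (x ∷ ys) ≡ x ∷ (replicate j x ++ ys)
rep-snoc zero x ys = refl
rep-snoc (suc j) x ys = cong (x ∷_) (rep-snoc j x ys)

H-read : ∀ f cr j m →
  hdrOut mRead (readInit f cr) (counterHeader (parity f) j (suc m)) ≡ counterHeader (parity f) (suc j) m ×
  hdrEnd mRead (hdrFin mRead (readInit f cr) (counterHeader (parity f) j (suc m))) ≡ rD f false cr (isZero m) false false true (isZero m)
H-read f cr j m with Hpre (readInit f cr) j (parity f ∷ replicate m (parity f)) refl (xor1 f)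
... | x , y rewrite hA2 (readInit f cr) (parity f) refl (xor2 f) =
  trans x (trans (cong (λ z → replicate j (not (parity f)) ++ (not (parity f) ∷ z)) (proj₁ (Hpost f false cr false (parity f) m)))
                 (rep-snoc j (not (parity f)) (replicate m (parity f)))) ,
  cong (hdrEnd mRead) (trans y (proj₂ (Hpost f false cr false (parity f) m)))

H-act : ∀ d us → hdrOut mAct d us ≡ us × hdrFin mAct d us ≡ d
H-act d [] = refl , refl
H-act d (u ∷ us) with H-act d us
... | x , y = cong (u ∷_) x , y

H-next : ∀ d us → hdrOut mNext d us ≡ replicate (length us) false × hdrFin mNext d us ≡ d
H-next d [] = refl , refl
H-next d (u ∷ us) with H-next d us
... | x , y = cong (false ∷_) x , y

cleanB : Bit → Bit
cleanB b = record b { cons = false ; bad = false }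

acceptBits : Bool → List Bit → Bool
acceptBits ac [] = ac
acceptBits ac (b ∷ bs) = acceptBits (ac ∧ implies (v b) (cov b)) bs

N-bits : ∀ r cr fo ac bs → bitsOut mNext r (nD cr fo ac) bs ≡ map cleanB bs × bitsFin mNext r (nD cr fo ac) bs ≡ nD cr fo (acceptBits ac bs)
N-bits r cr fo ac [] = refl , refl
N-bits r cr fo ac (b ∷ bs) with N-bits r cr fo (ac ∧ implies (v b) (cov b)) bs
... | x , y = cong (_ ∷_) x , y

cleanBk : Status → Block → Block
cleanBk s b = block s (map cleanB (q b)) (map cleanB (p b))

acceptBlock : Bool → Block → Bool
acceptBlock ac b = acceptBits (acceptBits ac (q b)) (p b)

acceptBlockList : Bool → List Block → Bool
acceptBlockList ac [] = ac
acceptBlockList ac (b ∷ bs) = acceptBlockList (acceptBlock ac b) bs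

NB-keep : ∀ r cr fo ac s s' b → proj₁ (nextLead r (nD cr fo ac) s) ≡ s' → proj₂ (nextLead r (nD cr fo ac) s) ≡ nD cr fo ac →
  st b ≡ s →
  blkOut mNext r (nD cr fo ac) b ≡ cleanBk s' b × blkFin mNext r (nD cr fo ac) b ≡ nD cr fo (acceptBlock ac b)
NB-keep r cr fo ac s s' (block .s qs ps) e1 e2 refl =
  blkEq mNext r (nD cr fo ac) s qs ps s' _ _ _ _ e1
    (trans (cong (λ z → bitsOut mNext r z qs) e2) (proj₁ (N-bits r cr fo ac qs)))
    (trans (cong (λ z → bitsFin mNext r z qs) e2) (proj₂ (N-bits r cr fo ac qs)))
    (proj₁ (N-bits r cr fo (acceptBits ac qs) ps)) (proj₂ (N-bits r cr fo (acceptBits ac qs) ps))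

NB-new : ∀ r cr ac b → st b ≡ fresh →
  blkOut mNext r (nD cr false ac) b ≡ cleanBk cur b × blkFin mNext r (nD cr false ac) b ≡ nD r true (acceptBlock ac b)
NB-new r cr ac (block .fresh qs ps) refl =
  blkEq mNext r (nD cr false ac) fresh qs ps cur _ _ _ _ refl
    (proj₁ (N-bits r r true ac qs)) (proj₂ (N-bits r r true ac qs))
    (proj₁ (N-bits r r true (acceptBits ac qs) ps)) (proj₂ (N-bits r r true (acceptBits ac qs) ps))

NBs-keep : ∀ r cr fo ac s s' bs → (∀ ac' → proj₁ (nextLead r (nD cr fo ac') s) ≡ s') →
  (∀ ac' → proj₂ (nextLead r (nD cr fo ac') s) ≡ nD cr fo ac') → All (λ b → st b ≡ s) bs →
  blksOut mNext r (nD cr fo ac) bs ≡ map (cleanBk s') bs × blksFin mNext r (nD cr fo ac) bs ≡ nD cr fo (acceptBlockList ac bs)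
NBs-keep r cr fo ac s s' [] e1 e2 [] = refl , refl
NBs-keep r cr fo ac s s' (b ∷ bs) e1 e2 (sb ∷ sbs) with NB-keep r cr fo ac s s' b (e1 ac) (e2 ac) sb
... | x , y with NBs-keep r cr fo (acceptBlock ac b) s s' bs e1 e2 sbs
... | x' , y' = cong₂ _∷_ x (trans (cong (λ z → blksOut mNext r z bs) y) x') , trans (cong (λ z → blksFin mNext r z bs) y) y'

blksOut-++ : ∀ m r d xs ys → blksOut m r d (xs ++ ys) ≡ blksOut m r d xs ++ blksOut m r (blksFin m r d xs) ys
blksOut-++ m r d [] ys = refl
blksOut-++ m r d (x ∷ xs) ys = cong (_ ∷_) (blksOut-++ m r _ xs ys)

blksFin-++ : ∀ m r d xs ys → blksFin m r d (xs ++ ys) ≡ blksFin m r (blksFin m r d xs) ys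
blksFin-++ m r d [] ys = refl
blksFin-++ m r d (x ∷ xs) ys = blksFin-++ m r _ xs ys

allNC : ∀ s → isCur s ≡ false → ∀ xs → All NotCurrent (map (toBs s) xs)
allNC s e [] = []
allNC s e (x ∷ xs) = e ∷ allNC s e xs

aroundCurrent : List BlockData → Block → List BlockData → List Block
aroundCurrent pre cb post = map (toBs done) pre ++ (cb ∷ map (toBs fresh) post)

tapeOriented : Bool → List Bool → List Block → List Block → Tape
tapeOriented false h X Y = tape h X Y
tapeOriented true h X Y = tape h Y X

ReadsBit : Fld → Bool → Block → Block → Bool → Set
ReadsBit f cr cbk cbk' cbv = ∀ c0 l i db jf → blkOut mRead cr (rD f c0 cr l i db true jf) cbk ≡ cbk' ×
  blkFin mRead cr (rD f c0 cr l i db true jf) cbk ≡ rD f cbv cr l true true true jf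

CRread : ∀ r f c0 l i db jf pre cbk cbk' cbv post → ReadsBit f r cbk cbk' cbv →
  blksOut mRead r (rD f c0 r l i db true jf) (aroundCurrent pre cbk post) ≡ aroundCurrent pre cbk' post ×
  ∃₂ λ i' db' → blksFin mRead r (rD f c0 r l i db true jf) (aroundCurrent pre cbk post) ≡ rD f cbv r l i' db' true jf
CRread r f c0 l i db jf pre cbk cbk' cbv post H
  with RBs-non r f c0 r l i db true jf (map (toBs done) pre) (allNC done refl pre)
... | e1 , i1 , db1 , e2 with H c0 l i1 db1 jf
... | e3 , e4 with RBs-non r f cbv r l true true true jf (map (toBs fresh) post) (allNC fresh refl post)
... | e5 , i2 , db2 , e6 =
  trans (blksOut-++ mRead r _ (map (toBs done) pre) (cbk ∷ map (toBs fresh) post))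
    (cong₂ _++_ e1 (trans (cong (λ z → blksOut mRead r z (cbk ∷ map (toBs fresh) post)) e2)
       (cong₂ _∷_ e3 (trans (cong (λ z → blksOut mRead r z (map (toBs fresh) post)) e4) e5)))) ,
  i2 , db2 , trans (blksFin-++ mRead r _ (map (toBs done) pre) (cbk ∷ map (toBs fresh) post))
    (trans (cong (λ z → blksFin mRead r z (cbk ∷ map (toBs fresh) post)) e2)
      (trans (cong (λ z → blksFin mRead r z (map (toBs fresh) post)) e4) e6))

H-read-fin : ∀ f cr j m → hdrFin mRead (readInit f cr) (counterHeader (parity f) j (suc m)) ≡ rD f false cr false false false true (isZero m)
H-read-fin f cr j m with Hpre (readInit f cr) j (parity f ∷ replicate m (parity f)) refl (xor1 f)
... | x , y rewrite hA2 (readInit f cr) (parity f) refl (xor2 f) = trans y (proj₂ (Hpost f false cr false (parity f) m))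

H-read-out : ∀ f cr j m → hdrOut mRead (readInit f cr) (counterHeader (parity f) j (suc m)) ≡ counterHeader (parity f) (suc j) m
H-read-out f cr j m = proj₁ (H-read f cr j m)

readSweep : ∀ cr f j m pre cbk cbk' cbv post tgts → ReadsBit f cr cbk cbk' cbv → All NotCurrent tgts →
  tOut mRead (readInit f cr) (tapeOriented cr (counterHeader (parity f) j (suc m)) (aroundCurrent pre cbk post) tgts) ≡ tapeOriented cr (counterHeader (parity f) (suc j) m) (aroundCurrent pre cbk' post) tgts ×
  ∃₂ λ i db → tFin mRead (readInit f cr) (tapeOriented cr (counterHeader (parity f) j (suc m)) (aroundCurrent pre cbk post) tgts) ≡ rD f cbv cr (isZero m) i db true (isZero m)
readSweep false f j m pre cbk cbk' cbv post tgts H nc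
  with CRread false f false (isZero m) false false (isZero m) pre cbk cbk' cbv post H
... | e1 , i1 , db1 , e2 with RBs-non true f cbv false (isZero m) i1 db1 true (isZero m) tgts nc
... | e3 , i2 , db2 , e4 =
  cong₃ tape (H-read-out f false j m)
    (trans (cong (λ z → blksOut mRead false (hdrEnd mRead z) (aroundCurrent pre cbk post)) (H-read-fin f false j m)) e1)
    (trans (cong (λ z → blksOut mRead true (blksFin mRead false (hdrEnd mRead z) (aroundCurrent pre cbk post)) tgts) (H-read-fin f false j m))
      (trans (cong (λ z → blksOut mRead true z tgts) e2) e3)) ,
  i2 , db2 , trans (cong (λ z → blksFin mRead true (blksFin mRead false (hdrEnd mRead z) (aroundCurrent pre cbk post)) tgts) (H-read-fin f false j m))
      (trans (cong (λ z → blksFin mRead true z tgts) e2) e4)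
readSweep true f j m pre cbk cbk' cbv post tgts H nc
  with RBs-non false f false true (isZero m) false false true (isZero m) tgts nc
... | e1 , i1 , db1 , e2 with CRread true f false (isZero m) i1 db1 (isZero m) pre cbk cbk' cbv post H
... | e3 , i2 , db2 , e4 =
  cong₃ tape (H-read-out f true j m)
    (trans (cong (λ z → blksOut mRead false (hdrEnd mRead z) tgts) (H-read-fin f true j m)) e1)
    (trans (cong (λ z → blksOut mRead true (blksFin mRead false (hdrEnd mRead z) tgts) (aroundCurrent pre cbk post)) (H-read-fin f true j m))
      (trans (cong (λ z → blksOut mRead true z (aroundCurrent pre cbk post)) e2) e3)) ,
  i2 , db2 , trans (cong (λ z → blksFin mRead true (blksFin mRead false (hdrEnd mRead z) tgts) (aroundCurrent pre cbk post)) (H-read-fin f true j m))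
      (trans (cong (λ z → blksFin mRead true z (aroundCurrent pre cbk post)) e2) e4)

ActsOnTargets : Fld → Bool → Bool → List Block → List Block → Set
ActsOnTargets f cr cbv tgts tgts' = ∀ l i db bb → blksOut mAct (not cr) (aD f cbv cr l i db bb) tgts ≡ tgts'

actSweep : ∀ cr f cbv l h X tgts tgts' → ActsOnTargets f cr cbv tgts tgts' →
  tOut mAct (aD f cbv cr l false false false) (tapeOriented cr h X tgts) ≡ tapeOriented cr h X tgts' ×
  ∃₂ λ i db → ∃ λ bb → tFin mAct (aD f cbv cr l false false false) (tapeOriented cr h X tgts) ≡ aD f cbv cr l i db bb
actSweep false f cbv l h X tgts tgts' H with ABs-off false f cbv false l false false false X refl
... | e1 , i1 , db1 , bb1 , e2 with A-fin-blks true f cbv false l i1 db1 bb1 tgts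
... | i , db , bb , e3 =
  cong₃ tape (proj₁ (H-act d0 h)) (trans (cong (λ z → blksOut mAct false z X) hAe) e1)
    (trans (cong (λ z → blksOut mAct true (blksFin mAct false z X) tgts) hAe)
       (trans (cong (λ z → blksOut mAct true z tgts) e2) (H l i1 db1 bb1))) ,
  i , db , bb , trans (cong (λ z → blksFin mAct true (blksFin mAct false z X) tgts) hAe)
      (trans (cong (λ z → blksFin mAct true z tgts) e2) e3)
  where
  d0 = aD f cbv false l false false false
  hAe = proj₂ (H-act d0 h)
actSweep true f cbv l h X tgts tgts' H with A-fin-blks false f cbv true l false false false tgts
... | i1 , db1 , bb1 , e2 with ABs-off true f cbv true l i1 db1 bb1 X refl
... | e3 , i2 , db2 , bb2 , e4 =
  cong₃ tape (proj₁ (H-act d0 h)) (trans (cong (λ z → blksOut mAct false z tgts) hAe) (H l false false false))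
    (trans (cong (λ z → blksOut mAct true (blksFin mAct false z tgts) X) hAe)
       (trans (cong (λ z → blksOut mAct true z X) e2) e3)) ,
  i2 , db2 , bb2 , trans (cong (λ z → blksFin mAct true (blksFin mAct false z tgts) X) hAe)
      (trans (cong (λ z → blksFin mAct true z X) e2) e4)
  where
  d0 = aD f cbv true l false false false
  hAe = proj₂ (H-act d0 h)

toCfg : End → Tape → Maybe MacroConfig
toCfg (halt' b) t = nothing
toCfg (next' m d) t = just (config m d t)

contEnd : Fld → Bool → ℕ → End
contEnd f cr m = if isZero m then afterAct f cr else next' mRead (readInit f cr)

macroStepsFrom-0 : ∀ e t → macroStepsFrom 0 e t ≡ toCfg e t
macroStepsFrom-0 (halt' b) t = refl
macroStepsFrom-0 (next' m d) t = refl

processBit : ∀ cr f j m pre cbk cbk' cbv post tgts tgts' → ReadsBit f cr cbk cbk' cbv → ActsOnTargets f cr cbv tgts tgts' → All NotCurrent tgts →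
  macroSteps 2 (config mRead (readInit f cr) (tapeOriented cr (counterHeader (parity f) j (suc m)) (aroundCurrent pre cbk post) tgts)) ≡
  toCfg (contEnd f cr m) (tapeOriented cr (counterHeader (parity f) (suc j) m) (aroundCurrent pre cbk' post) tgts')
processBit cr f j m pre cbk cbk' cbv post tgts tgts' H1 H2 nc
  with readSweep cr f j m pre cbk cbk' cbv post tgts H1 nc
... | e1 , i , db , e2
  with actSweep cr f cbv (isZero m) (counterHeader (parity f) (suc j) m) (aroundCurrent pre cbk' post) tgts tgts' H2
... | e3 , i' , db' , bb' , e4 =
  trans (cong₂ (macroStepsFrom 1) (cong (endA mRead) e2) e1)
    (trans (cong₂ (macroStepsFrom 0) (cong (endA mAct) e4) e3) (macroStepsFrom-0 _ _))

thenMacroSteps : Maybe MacroConfig → ℕ → Maybe MacroConfig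
thenMacroSteps nothing b = nothing
thenMacroSteps (just c) b = macroSteps b c

macroSteps-+ : ∀ a b c → macroSteps (a + b) c ≡ thenMacroSteps (macroSteps a c) b
macroStepsFrom-+ : ∀ a b e t → macroStepsFrom (a + b) e t ≡ thenMacroSteps (macroStepsFrom a e t) b
macroSteps-+ zero b c = refl
macroSteps-+ (suc a) b c = macroStepsFrom-+ a b (macroEnd c) (macroTape c)
macroStepsFrom-+ a b (halt' x) t = refl
macroStepsFrom-+ a b (next' m d) t = macroSteps-+ a b (config m d t)

double : ℕ → ℕ
double zero = 0
double (suc m) = suc (suc (double m))

+-suc≡⇒< : ∀ j m n → j + suc m ≡ n → j < n
+-suc≡⇒< j m n e = subst (j <_) e (m<m+n j (s≤s z≤n))

processField : ∀ cr f n pre post (cF : ℕ → Block) (cbvF : ℕ → Bool) (tF : ℕ → List Block) →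
  (∀ j → j < n → ReadsBit f cr (cF j) (cF (suc j)) (cbvF j)) →
  (∀ j → j < n → ActsOnTargets f cr (cbvF j) (tF j) (tF (suc j))) →
  (∀ j → All NotCurrent (tF j)) →
  ∀ m j → j + suc m ≡ n →
  macroSteps (double (suc m)) (config mRead (readInit f cr) (tapeOriented cr (counterHeader (parity f) j (suc m)) (aroundCurrent pre (cF j) post) (tF j))) ≡
  toCfg (afterAct f cr) (tapeOriented cr (counterHeader (parity f) n 0) (aroundCurrent pre (cF n) post) (tF n))
processField cr f n pre post cF cbvF tF H1 H2 H3 zero j e with trans (+-comm 1 j) e
... | refl = processBit cr f j 0 pre (cF j) (cF (suc j)) (cbvF j) post (tF j) (tF (suc j))
               (H1 j (+-suc≡⇒< j 0 n e)) (H2 j (+-suc≡⇒< j 0 n e)) (H3 j)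
processField cr f n pre post cF cbvF tF H1 H2 H3 (suc m) j e =
  trans (macroSteps-+ 2 (double (suc m)) (config mRead (readInit f cr) (tapeOriented cr (counterHeader (parity f) j (suc (suc m))) (aroundCurrent pre (cF j) post) (tF j))))
    (trans (cong (λ z → thenMacroSteps z (double (suc m)))
              (processBit cr f j (suc m) pre (cF j) (cF (suc j)) (cbvF j) post (tF j) (tF (suc j))
                 (H1 j (+-suc≡⇒< j (suc m) n e)) (H2 j (+-suc≡⇒< j (suc m) n e)) (H3 j)))
      (processField cr f n pre post cF cbvF tF H1 H2 H3 m (suc j) (trans (sym (+-suc j (suc m))) e)))

targetStatus : Bool → Status
targetStatus false = fresh
targetStatus true = done

tgtNC : ∀ cr → isCur (targetStatus cr) ≡ false
tgtNC false = refl
tgtNC true = refl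

allNCT : ∀ cr c kq kp ts → All NotCurrent (map (targetBlock (targetStatus cr) c kq kp) ts)
allNCT cr c kq kp [] = []
allNCT cr c kq kp (t ∷ ts) = tgtNC cr ∷ allNCT cr c kq kp ts

notx : ∀ cr → not cr xor cr ≡ true
notx false = refl
notx true = refl

RB-curP' : ∀ r f c0 cr l i db hf jf K kp c → length (sq c) ≡ K → kp < length (sp c) →
  blkOut mRead r (rD f c0 cr l i db hf jf) (currentBlock K kp c) ≡ currentBlock K (suc kp) c ×
  blkFin mRead r (rD f c0 cr l i db hf jf) (currentBlock K kp c) ≡ rD f (nthValue kp (sp c)) cr l true true hf jf
RB-curP' r f c0 cr l i db hf jf .(length (sq c)) kp c refl lt = RB-curP r f c0 cr l i db hf jf kp c lt

AB-P' : ∀ r cr l i db bb s kp c t K → (r xor cr) ≡ true → length (sq c) ≡ K →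
  length (sq c) ≡ length (sq t) → kp < length (sp c) → kp < length (sp t) →
  blkOut mAct r (aD fP (nthValue kp (sp c)) cr l i db bb) (targetBlock s c K kp t) ≡ targetBlock s c K (suc kp) t
AB-P' r cr l i db bb s kp c t .(length (sq c)) e refl eq lt1 lt2 = AB-P r cr l i db bb s kp c t e eq lt1 lt2

-- Guards R ++ I of length 2n, products of length n.
Shaped : ℕ → BlockData → Set
Shaped n t = length (sq t) ≡ n + n × length (sp t) ≡ n

readField-R : ∀ cr n' pre post c ts → Shaped (suc n') c → All (Shaped (suc n')) ts →
  macroSteps (double (suc n'))
    (config mRead (readInit fR cr) (tapeOriented cr (replicate (suc n') false) (aroundCurrent pre (currentBlock 0 0 c) post) (map (targetBlock (targetStatus cr) c 0 0) ts))) ≡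
  just (config mRead (readInit fI cr)
    (tapeOriented cr (replicate (suc n') true ++ []) (aroundCurrent pre (currentBlock (suc n') 0 c) post) (map (targetBlock (targetStatus cr) c (suc n') 0) ts)))
readField-R cr n' pre post c ts (lq , lp) lts =
  processField cr fR n pre post (λ j → currentBlock j 0 c) (λ j → nthValue j (sq c)) (λ j → map (targetBlock (targetStatus cr) c j 0) ts)
    (λ j lt c0 l i db jf → RB-curQ cr fR c0 cr l i db true jf j c (subst (j <_) (sym lq) (j<n+n j lt)))
    (λ j lt l i db bb → ABs-mapA (not cr) fR (nthValue j (sq c)) cr l (Shaped n) (targetBlock (targetStatus cr) c j 0) (targetBlock (targetStatus cr) c (suc j) 0) ts lts
        (λ i db bb t lt' → AB-Q (not cr) fR cr l i db bb (targetStatus cr) j c t (notx cr) (λ _ _ _ → refl)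
            (subst (j <_) (sym lq) (j<n+n j lt)) (subst (j <_) (sym (proj₁ lt')) (j<n+n j lt))) i db bb)
    (λ j → allNCT cr c j 0 ts) n' 0 refl
  where
  n = suc n'
  j<n+n : ∀ j → j < n → j < n + n
  j<n+n j lt = <-≤-trans lt (m≤m+n n n)

readField-I : ∀ cr n' pre post c ts → Shaped (suc n') c → All (Shaped (suc n')) ts →
  macroSteps (double (suc n'))
    (config mRead (readInit fI cr) (tapeOriented cr (replicate (suc n') true) (aroundCurrent pre (currentBlock (suc n') 0 c) post) (map (targetBlock (targetStatus cr) c (suc n') 0) ts))) ≡
  just (config mRead (readInit fP cr)
    (tapeOriented cr (replicate (suc n') false ++ []) (aroundCurrent pre (currentBlock (suc n' + suc n') 0 c) post) (map (targetBlock (targetStatus cr) c (suc n' + suc n') 0) ts)))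
readField-I cr n' pre post c ts (lq , lp) lts =
  processField cr fI n pre post (λ j → currentBlock (j + n) 0 c) (λ j → nthValue (j + n) (sq c)) (λ j → map (targetBlock (targetStatus cr) c (j + n) 0) ts)
    (λ j lt c0 l i db jf → RB-curQ cr fI c0 cr l i db true jf (j + n) c (subst (j + n <_) (sym lq) (+-monoˡ-< n lt)))
    (λ j lt l i db bb → ABs-mapA (not cr) fI (nthValue (j + n) (sq c)) cr l (Shaped n) (targetBlock (targetStatus cr) c (j + n) 0) (targetBlock (targetStatus cr) c (suc j + n) 0) ts lts
        (λ i db bb t lt' → AB-Q (not cr) fI cr l i db bb (targetStatus cr) (j + n) c t (notx cr) (λ _ _ _ → refl)
            (subst (j + n <_) (sym lq) (+-monoˡ-< n lt)) (subst (j + n <_) (sym (proj₁ lt')) (+-monoˡ-< n lt))) i db bb)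
    (λ j → allNCT cr c (j + n) 0 ts) n' 0 refl
  where
  n = suc n'

readField-P : ∀ cr n' pre post c ts → Shaped (suc n') c → All (Shaped (suc n')) ts →
  macroSteps (double (suc n'))
    (config mRead (readInit fP cr) (tapeOriented cr (replicate (suc n') false) (aroundCurrent pre (currentBlock (suc n' + suc n') 0 c) post) (map (targetBlock (targetStatus cr) c (suc n' + suc n') 0) ts))) ≡
  just (config mNext nextInit
    (tapeOriented cr (replicate (suc n') true ++ []) (aroundCurrent pre (currentBlock (suc n' + suc n') (suc n') c) post) (map (targetBlock (targetStatus cr) c (suc n' + suc n') (suc n')) ts)))
readField-P cr n' pre post c ts (lq , lp) lts =
  processField cr fP n pre post (λ j → currentBlock (n + n) j c) (λ j → nthValue j (sp c)) (λ j → map (targetBlock (targetStatus cr) c (n + n) j) ts)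
    (λ j lt c0 l i db jf → RB-curP' cr fP c0 cr l i db true jf (n + n) j c lq (subst (j <_) (sym lp) lt))
    (λ j lt l i db bb → ABs-mapA (not cr) fP (nthValue j (sp c)) cr l (Shaped n) (targetBlock (targetStatus cr) c (n + n) j) (targetBlock (targetStatus cr) c (n + n) (suc j)) ts lts
        (λ i db bb t lt' → AB-P' (not cr) cr l i db bb (targetStatus cr) j c t (n + n) (notx cr) lq (trans lq (sym (proj₁ lt')))
            (subst (j <_) (sym lp) lt) (subst (j <_) (sym (proj₂ lt')) lt)) i db bb)
    (λ j → allNCT cr c (n + n) j ts) n' 0 refl
  where
  n = suc n'

processCurrent : ∀ cr n' pre post c ts → Shaped (suc n') c → All (Shaped (suc n')) ts →
  macroSteps (double (suc n') + (double (suc n') + double (suc n')))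
    (config mRead (readInit fR cr) (tapeOriented cr (replicate (suc n') false) (aroundCurrent pre (currentBlock 0 0 c) post) (map (targetBlock (targetStatus cr) c 0 0) ts))) ≡
  just (config mNext nextInit (tapeOriented cr (replicate (suc n') true ++ []) (aroundCurrent pre (currentBlock (suc n' + suc n') (suc n') c) post)
                                  (map (targetBlock (targetStatus cr) c (suc n' + suc n') (suc n')) ts)))
processCurrent cr n' pre post c ts lc lts = begin
  macroSteps (double n + (double n + double n)) (config mRead (readInit fR cr) (tape₀ (replicate n false) 0 0))
    ≡⟨ macroSteps-+ (double n) (double n + double n) (config mRead (readInit fR cr) (tape₀ (replicate n false) 0 0)) ⟩
  thenMacroSteps (macroSteps (double n) (config mRead (readInit fR cr) (tape₀ (replicate n false) 0 0))) (double n + double n)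
    ≡⟨ cong (λ z → thenMacroSteps z (double n + double n)) (readField-R cr n' pre post c ts lc lts) ⟩
  macroSteps (double n + double n) (config mRead (readInit fI cr) (tape₀ (replicate n true ++ []) n 0))
    ≡⟨ cong (λ h → macroSteps (double n + double n) (config mRead (readInit fI cr) (tape₀ h n 0))) (++-identityʳ (replicate n true)) ⟩
  macroSteps (double n + double n) (config mRead (readInit fI cr) (tape₀ (replicate n true) n 0))
    ≡⟨ macroSteps-+ (double n) (double n) (config mRead (readInit fI cr) (tape₀ (replicate n true) n 0)) ⟩
  thenMacroSteps (macroSteps (double n) (config mRead (readInit fI cr) (tape₀ (replicate n true) n 0))) (double n)
    ≡⟨ cong (λ z → thenMacroSteps z (double n)) (readField-I cr n' pre post c ts lc lts) ⟩
  macroSteps (double n) (config mRead (readInit fP cr) (tape₀ (replicate n false ++ []) (n + n) 0))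
    ≡⟨ cong (λ h → macroSteps (double n) (config mRead (readInit fP cr) (tape₀ h (n + n) 0))) (++-identityʳ (replicate n false)) ⟩
  macroSteps (double n) (config mRead (readInit fP cr) (tape₀ (replicate n false) (n + n) 0))
    ≡⟨ readField-P cr n' pre post c ts lc lts ⟩
  just (config mNext nextInit (tape₀ (replicate n true ++ []) (n + n) n)) ∎
  where
  open ≡-Reasoning
  n = suc n'
  tape₀ : List Bool → ℕ → ℕ → Tape
  tape₀ h kq kp = tapeOriented cr h (aroundCurrent pre (currentBlock kq kp c) post) (map (targetBlock (targetStatus cr) c kq kp) ts)

coverGuards : List BitPair → List BitPair
coverGuards = map (λ x → (proj₁ x , true))

coverProducts : Bool → List BitPair → List BitPair → List BitPair
coverProducts ok [] ts = ts
coverProducts ok (c ∷ cs) [] = []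
coverProducts ok (c ∷ cs) (t ∷ ts) = (proj₁ t , proj₂ t ∨ (ok ∧ proj₁ c)) ∷ coverProducts ok cs ts

coverWith : BlockData → BlockData → BlockData
coverWith c t = blockData (coverGuards (sq t)) (coverProducts (okQ (sq c) (sq t)) (sp c) (sp t))

cl-cln : ∀ xs → map cleanB (map bitOf xs) ≡ map bitOf xs
cl-cln [] = refl
cl-cln (x ∷ xs) = cong (_ ∷_) (cl-cln xs)

cl-mark : ∀ k xs → map cleanB (markFirst k (map bitOf xs)) ≡ map bitOf xs
cl-mark zero xs = cl-cln xs
cl-mark (suc k) [] = refl
cl-mark (suc k) (x ∷ xs) = cong (_ ∷_) (cl-mark k xs)

cl-zq : ∀ cs ts → length cs ≡ length ts → map cleanB (actOnGuards (length cs) cs (map bitOf ts)) ≡ map bitOf (coverGuards ts)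
cl-zq [] [] e = refl
cl-zq (c ∷ cs) (t ∷ ts) e = cong (_ ∷_) (cl-zq cs ts (cong pred e))

cl-zp : ∀ ok cs ts → length cs ≡ length ts → map cleanB (actOnProducts ok (length cs) cs (map bitOf ts)) ≡ map bitOf (coverProducts ok cs ts)
cl-zp ok [] [] e = refl
cl-zp ok (c ∷ cs) (t ∷ ts) e = cong (_ ∷_) (cl-zp ok cs ts (cong pred e))

cl-colT : ∀ s s' c t K k → K ≡ length (sq c) → k ≡ length (sp c) → length (sq c) ≡ length (sq t) → length (sp c) ≡ length (sp t) →
  cleanBk s (targetBlock s' c K k t) ≡ toBs s (coverWith c t)
cl-colT s s' c t .(length (sq c)) .(length (sp c)) refl refl e1 e2 =
  cong₂ (block s) (cl-zq (sq c) (sq t) e1) (cl-zp (okQ (sq c) (sq t)) (sp c) (sp t) e2)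

cl-colC : ∀ s K k c → cleanBk s (currentBlock K k c) ≡ toBs s c
cl-colC s K k c = cong₂ (block s) (cl-mark K (sq c)) (cl-mark k (sp c))

cl-toBs : ∀ s s' x → cleanBk s (toBs s' x) ≡ toBs s x
cl-toBs s s' x = cong₂ (block s) (cl-cln (sq x)) (cl-cln (sp x))

allSt : ∀ s xs → All (λ b → st b ≡ s) (map (toBs s) xs)
allSt s [] = []
allSt s (x ∷ xs) = refl ∷ allSt s xs

allStT : ∀ s c K k xs → All (λ b → st b ≡ s) (map (targetBlock s c K k) xs)
allStT s c K k [] = []
allStT s c K k (x ∷ xs) = refl ∷ allStT s c K k xs

NX-done : ∀ r cr fo ac bs → All (λ b → st b ≡ done) bs →
  blksOut mNext r (nD cr fo ac) bs ≡ map (cleanBk done) bs × blksFin mNext r (nD cr fo ac) bs ≡ nD cr fo (acceptBlockList ac bs)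
NX-done r cr fo ac bs a = NBs-keep r cr fo ac done done bs (λ _ → refl) (λ _ → refl) a

NX-freshT : ∀ r cr ac bs → All (λ b → st b ≡ fresh) bs →
  blksOut mNext r (nD cr true ac) bs ≡ map (cleanBk fresh) bs × blksFin mNext r (nD cr true ac) bs ≡ nD cr true (acceptBlockList ac bs)
NX-freshT r cr ac bs a = NBs-keep r cr true ac fresh fresh bs (λ _ → refl) (λ _ → refl) a

NX-freshF : ∀ r cr ac b bs → st b ≡ fresh → All (λ b → st b ≡ fresh) bs →
  blksOut mNext r (nD cr false ac) (b ∷ bs) ≡ cleanBk cur b ∷ map (cleanBk fresh) bs ×
  blksFin mNext r (nD cr false ac) (b ∷ bs) ≡ nD r true (acceptBlockList ac (b ∷ bs))
NX-freshF r cr ac b bs sb a with NB-new r cr ac b sb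
... | x , y = cong₂ _∷_ x (trans (cong (λ z → blksOut mNext r z bs) y) (proj₁ (NX-freshT r r (acceptBlock ac b) bs a))) ,
              trans (cong (λ z → blksFin mNext r z bs) y) (proj₂ (NX-freshT r r (acceptBlock ac b) bs a))

NX-CR-mid : ∀ r cr ac pre cbk x post → st cbk ≡ cur →
  blksOut mNext r (nD cr false ac) (aroundCurrent pre cbk (x ∷ post)) ≡
    map (cleanBk done) (map (toBs done) pre) ++ (cleanBk done cbk ∷ cleanBk cur (toBs fresh x) ∷ map (cleanBk fresh) (map (toBs fresh) post)) ×
  ∃ λ ac' → blksFin mNext r (nD cr false ac) (aroundCurrent pre cbk (x ∷ post)) ≡ nD r true ac'
NX-CR-mid r cr ac pre cbk x post sc
  with NX-done r cr false ac (map (toBs done) pre) (allSt done pre)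
... | e1 , e2 with NB-keep r cr false (acceptBlockList ac (map (toBs done) pre)) cur done cbk refl refl sc
... | e3 , e4 with NX-freshF r cr (acceptBlock (acceptBlockList ac (map (toBs done) pre)) cbk) (toBs fresh x) (map (toBs fresh) post) refl (allSt fresh post)
... | e5 , e6 =
  trans (blksOut-++ mNext r _ (map (toBs done) pre) _)
    (cong₂ _++_ e1 (trans (cong (λ z → blksOut mNext r z (cbk ∷ toBs fresh x ∷ map (toBs fresh) post)) e2)
      (cong₂ _∷_ e3 (trans (cong (λ z → blksOut mNext r z (toBs fresh x ∷ map (toBs fresh) post)) e4) e5)))) ,
  _ , trans (blksFin-++ mNext r _ (map (toBs done) pre) _)
    (trans (cong (λ z → blksFin mNext r z (cbk ∷ toBs fresh x ∷ map (toBs fresh) post)) e2)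
      (trans (cong (λ z → blksFin mNext r z (toBs fresh x ∷ map (toBs fresh) post)) e4) e6))

NX-CR-end : ∀ r cr ac pre cbk → st cbk ≡ cur →
  blksOut mNext r (nD cr false ac) (aroundCurrent pre cbk []) ≡ map (cleanBk done) (map (toBs done) pre) ++ (cleanBk done cbk ∷ []) ×
  blksFin mNext r (nD cr false ac) (aroundCurrent pre cbk []) ≡ nD cr false (acceptBlockList ac (aroundCurrent pre cbk []))
NX-CR-end r cr ac pre cbk sc
  with NX-done r cr false ac (map (toBs done) pre) (allSt done pre)
... | e1 , e2 with NB-keep r cr false (acceptBlockList ac (map (toBs done) pre)) cur done cbk refl refl sc
... | e3 , e4 =
  trans (blksOut-++ mNext r _ (map (toBs done) pre) _)
    (cong₂ _++_ e1 (trans (cong (λ z → blksOut mNext r z (cbk ∷ [])) e2) (cong (_∷ []) e3))) ,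
  trans (blksFin-++ mNext r _ (map (toBs done) pre) _)
    (trans (cong (λ z → blksFin mNext r z (cbk ∷ [])) e2)
      (trans e4 (cong (nD cr false) (sym (accBs-++ ac (map (toBs done) pre) (cbk ∷ []))))))
  where
  accBs-++ : ∀ ac xs ys → acceptBlockList ac (xs ++ ys) ≡ acceptBlockList (acceptBlockList ac xs) ys
  accBs-++ ac [] ys = refl
  accBs-++ ac (x ∷ xs) ys = accBs-++ (acceptBlock ac x) xs ys

Shaped-coverWith : ∀ n c t → Shaped n t → Shaped n (coverWith c t)
Shaped-coverWith n c t (e1 , e2) = trans (length-map _ (sq t)) e1 , trans (lp (okQ (sq c) (sq t)) (sp c) (sp t)) e2
  where
  lp : ∀ ok cs ts → length (coverProducts ok cs ts) ≡ length ts
  lp ok [] ts = refl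
  lp ok (c ∷ cs) [] = refl
  lp ok (c ∷ cs) (t ∷ ts) = cong suc (lp ok cs ts)

Shaped-map-coverWith : ∀ n c ts → All (Shaped n) ts → All (Shaped n) (map (coverWith c) ts)
Shaped-map-coverWith n c [] [] = []
Shaped-map-coverWith n c (t ∷ ts) (l ∷ ls) = Shaped-coverWith n c t l ∷ Shaped-map-coverWith n c ts ls

clT-map : ∀ s s' c n ts → Shaped n c → All (Shaped n) ts →
  map (cleanBk s) (map (targetBlock s' c (n + n) n) ts) ≡ map (toBs s) (map (coverWith c) ts)
clT-map s s' c n [] lc [] = refl
clT-map s s' c n (t ∷ ts) lc (lt ∷ lts) =
  cong₂ _∷_ (cl-colT s s' c t (n + n) n (sym (proj₁ lc)) (sym (proj₂ lc)) (trans (proj₁ lc) (sym (proj₁ lt))) (trans (proj₂ lc) (sym (proj₂ lt))))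
            (clT-map s s' c n ts lc lts)

clD-map : ∀ s s' xs → map (cleanBk s) (map (toBs s') xs) ≡ map (toBs s) xs
clD-map s s' [] = refl
clD-map s s' (x ∷ xs) = cong₂ _∷_ (cl-toBs s s' x) (clD-map s s' xs)

hdr-len : ∀ n → length (replicate n true ++ []) ≡ n
hdr-len n = trans (cong length (++-identityʳ (replicate n true))) (length-replicate n)

H-next-rep : ∀ n → hdrOut mNext nextInit (replicate n true ++ []) ≡ replicate n false
H-next-rep n = trans (proj₁ (H-next nextInit (replicate n true ++ []))) (cong (λ z → replicate z false) (hdr-len n))

H-next-rep0 : ∀ n → hdrOut mNext nextInit (replicate n false) ≡ replicate n false
H-next-rep0 n = trans (proj₁ (H-next nextInit (replicate n false))) (cong (λ z → replicate z false) (length-replicate n))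

CRmid-eq : ∀ pre c K k c2 post →
  map (cleanBk done) (map (toBs done) pre) ++ (cleanBk done (currentBlock K k c) ∷ cleanBk cur (toBs fresh c2) ∷ map (cleanBk fresh) (map (toBs fresh) post))
  ≡ aroundCurrent (pre ++ c ∷ []) (currentBlock 0 0 c2) post
CRmid-eq pre c K k c2 post =
  trans (cong₂ _++_ (clD-map done done pre)
          (cong₂ _∷_ (cl-colC done K k c) (cong₂ _∷_ (cl-toBs cur fresh c2) (clD-map fresh fresh post))))
    (trans (sym (++-assoc (map (toBs done) pre) (toBs done c ∷ []) _))
      (cong (_++ (toBs cur c2 ∷ map (toBs fresh) post)) (sym (map-++ (toBs done) pre (c ∷ [])))))

CRend-eq : ∀ pre c K k →
  map (cleanBk done) (map (toBs done) pre) ++ (cleanBk done (currentBlock K k c) ∷ []) ≡ map (toBs done) (pre ++ c ∷ [])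
CRend-eq pre c K k = trans (cong₂ _++_ (clD-map done done pre) (cong (_∷ []) (cl-colC done K k c))) (sym (map-++ (toBs done) pre (c ∷ [])))

NxA-mid : ∀ n pre c c2 post ts → Shaped n c → All (Shaped n) ts →
  macroSteps 1 (config mNext nextInit (tape (replicate n true ++ []) (aroundCurrent pre (currentBlock (n + n) n c) (c2 ∷ post)) (map (targetBlock fresh c (n + n) n) ts))) ≡
  just (config mRead (readInit fR false) (tape (replicate n false) (aroundCurrent (pre ++ c ∷ []) (currentBlock 0 0 c2) post) (map (toBs fresh) (map (coverWith c) ts))))
NxA-mid n pre c c2 post ts lc lts
  with NX-CR-mid false false true pre (currentBlock (n + n) n c) c2 post refl
... | e1 , ac' , e2 with NX-freshT true false ac' (map (targetBlock fresh c (n + n) n) ts) (allStT fresh c (n + n) n ts)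
... | e3 , e4 =
  trans (cong₂ (macroStepsFrom 0) (cong (endA mNext) fin) out) refl
  where
  h = replicate n true ++ []
  X = aroundCurrent pre (currentBlock (n + n) n c) (c2 ∷ post)
  Y = map (targetBlock fresh c (n + n) n) ts
  hf = proj₂ (H-next nextInit h)
  fin : tFin mNext nextInit (tape h X Y) ≡ nD false true (acceptBlockList ac' Y)
  fin = trans (cong (λ z → blksFin mNext true (blksFin mNext false z X) Y) hf) (trans (cong (λ z → blksFin mNext true z Y) e2) e4)
  out : tOut mNext nextInit (tape h X Y) ≡ tape (replicate n false) (aroundCurrent (pre ++ c ∷ []) (currentBlock 0 0 c2) post) (map (toBs fresh) (map (coverWith c) ts))
  out = cong₃ tape (H-next-rep n)
          (trans (cong (λ z → blksOut mNext false z X) hf) (trans e1 (CRmid-eq pre c (n + n) n c2 post)))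
          (trans (cong (λ z → blksOut mNext true (blksFin mNext false z X) Y) hf)
             (trans (cong (λ z → blksOut mNext true z Y) e2) (trans e3 (clT-map fresh fresh c n ts lc lts))))

NxA-toB : ∀ n pre c t ts → Shaped n c → All (Shaped n) (t ∷ ts) →
  macroSteps 1 (config mNext nextInit (tape (replicate n true ++ []) (aroundCurrent pre (currentBlock (n + n) n c) []) (map (targetBlock fresh c (n + n) n) (t ∷ ts)))) ≡
  just (config mRead (readInit fR true) (tape (replicate n false) (map (toBs done) (pre ++ c ∷ [])) (aroundCurrent [] (currentBlock 0 0 (coverWith c t)) (map (coverWith c) ts))))
NxA-toB n pre c t ts lc (lt ∷ lts)
  with NX-CR-end false false true pre (currentBlock (n + n) n c) refl
... | e1 , e2 with NX-freshF true false (acceptBlockList true (aroundCurrent pre (currentBlock (n + n) n c) [])) (targetBlock fresh c (n + n) n t) (map (targetBlock fresh c (n + n) n) ts) refl (allStT fresh c (n + n) n ts)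
... | e3 , e4 =
  cong₂ (macroStepsFrom 0) (cong (endA mNext) fin) out
  where
  h = replicate n true ++ []
  X = aroundCurrent pre (currentBlock (n + n) n c) []
  Y = map (targetBlock fresh c (n + n) n) (t ∷ ts)
  hf = proj₂ (H-next nextInit h)
  fin : tFin mNext nextInit (tape h X Y) ≡ nD true true (acceptBlockList (acceptBlockList true X) Y)
  fin = trans (cong (λ z → blksFin mNext true (blksFin mNext false z X) Y) hf) (trans (cong (λ z → blksFin mNext true z Y) e2) e4)
  out : tOut mNext nextInit (tape h X Y) ≡ tape (replicate n false) (map (toBs done) (pre ++ c ∷ [])) (aroundCurrent [] (currentBlock 0 0 (coverWith c t)) (map (coverWith c) ts))
  out = cong₃ tape (H-next-rep n)
          (trans (cong (λ z → blksOut mNext false z X) hf) (trans e1 (CRend-eq pre c (n + n) n)))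
          (trans (cong (λ z → blksOut mNext true (blksFin mNext false z X) Y) hf)
             (trans (cong (λ z → blksOut mNext true z Y) e2) (trans e3
               (cong₂ _∷_ (cl-colT cur fresh c t (n + n) n (sym (proj₁ lc)) (sym (proj₂ lc)) (trans (proj₁ lc) (sym (proj₁ lt))) (trans (proj₂ lc) (sym (proj₂ lt))))
                          (clT-map fresh fresh c n ts lc lts)))))

NxB-mid : ∀ n pre c c2 post ts → Shaped n c → All (Shaped n) ts →
  macroSteps 1 (config mNext nextInit (tape (replicate n true ++ []) (map (targetBlock done c (n + n) n) ts) (aroundCurrent pre (currentBlock (n + n) n c) (c2 ∷ post)))) ≡
  just (config mRead (readInit fR true) (tape (replicate n false) (map (toBs done) (map (coverWith c) ts)) (aroundCurrent (pre ++ c ∷ []) (currentBlock 0 0 c2) post)))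
NxB-mid n pre c c2 post ts lc lts
  with NX-done false false false true (map (targetBlock done c (n + n) n) ts) (allStT done c (n + n) n ts)
... | e1 , e2 with NX-CR-mid true false (acceptBlockList true (map (targetBlock done c (n + n) n) ts)) pre (currentBlock (n + n) n c) c2 post refl
... | e3 , ac' , e4 =
  cong₂ (macroStepsFrom 0) (cong (endA mNext) fin) out
  where
  h = replicate n true ++ []
  X = map (targetBlock done c (n + n) n) ts
  Y = aroundCurrent pre (currentBlock (n + n) n c) (c2 ∷ post)
  hf = proj₂ (H-next nextInit h)
  fin : tFin mNext nextInit (tape h X Y) ≡ nD true true ac'
  fin = trans (cong (λ z → blksFin mNext true (blksFin mNext false z X) Y) hf) (trans (cong (λ z → blksFin mNext true z Y) e2) e4)
  out : tOut mNext nextInit (tape h X Y) ≡ tape (replicate n false) (map (toBs done) (map (coverWith c) ts)) (aroundCurrent (pre ++ c ∷ []) (currentBlock 0 0 c2) post)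
  out = cong₃ tape (H-next-rep n)
          (trans (cong (λ z → blksOut mNext false z X) hf) (trans e1 (clT-map done done c n ts lc lts)))
          (trans (cong (λ z → blksOut mNext true (blksFin mNext false z X) Y) hf)
             (trans (cong (λ z → blksOut mNext true z Y) e2) (trans e3 (CRmid-eq pre c (n + n) n c2 post))))

Nx0-A : ∀ n a as bs →
  macroSteps 1 (config mNext nextInit (tape (replicate n false) (map (toBs fresh) (a ∷ as)) (map (toBs fresh) bs))) ≡
  just (config mRead (readInit fR false) (tape (replicate n false) (aroundCurrent [] (currentBlock 0 0 a) as) (map (toBs fresh) bs)))
Nx0-A n a as bs
  with NX-freshF false false true (toBs fresh a) (map (toBs fresh) as) refl (allSt fresh as)
... | e1 , e2 with NX-freshT true false (acceptBlockList true (map (toBs fresh) (a ∷ as))) (map (toBs fresh) bs) (allSt fresh bs)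
... | e3 , e4 =
  cong₂ (macroStepsFrom 0) (cong (endA mNext) fin) out
  where
  h = replicate n false
  X = map (toBs fresh) (a ∷ as)
  Y = map (toBs fresh) bs
  hf = proj₂ (H-next nextInit h)
  fin : tFin mNext nextInit (tape h X Y) ≡ nD false true (acceptBlockList (acceptBlockList true X) Y)
  fin = trans (cong (λ z → blksFin mNext true (blksFin mNext false z X) Y) hf) (trans (cong (λ z → blksFin mNext true z Y) e2) e4)
  out : tOut mNext nextInit (tape h X Y) ≡ tape (replicate n false) (aroundCurrent [] (currentBlock 0 0 a) as) (map (toBs fresh) bs)
  out = cong₃ tape (H-next-rep0 n)
          (trans (cong (λ z → blksOut mNext false z X) hf) (trans e1 (cong₂ _∷_ (cl-toBs cur fresh a) (clD-map fresh fresh as))))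
          (trans (cong (λ z → blksOut mNext true (blksFin mNext false z X) Y) hf)
             (trans (cong (λ z → blksOut mNext true z Y) e2) (trans e3 (clD-map fresh fresh bs))))

Nx0-B : ∀ n b bs →
  macroSteps 1 (config mNext nextInit (tape (replicate n false) [] (map (toBs fresh) (b ∷ bs)))) ≡
  just (config mRead (readInit fR true) (tape (replicate n false) [] (aroundCurrent [] (currentBlock 0 0 b) bs)))
Nx0-B n b bs
  with NX-freshF true false true (toBs fresh b) (map (toBs fresh) bs) refl (allSt fresh bs)
... | e3 , e4 =
  cong₂ (macroStepsFrom 0) (cong (endA mNext) fin) out
  where
  h = replicate n false
  Y = map (toBs fresh) (b ∷ bs)
  hf = proj₂ (H-next nextInit h)
  fin : tFin mNext nextInit (tape h [] Y) ≡ nD true true (acceptBlockList true Y)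
  fin = trans (cong (λ z → blksFin mNext true z Y) hf) e4
  out : tOut mNext nextInit (tape h [] Y) ≡ tape (replicate n false) [] (aroundCurrent [] (currentBlock 0 0 b) bs)
  out = cong₃ tape (H-next-rep0 n) refl
          (trans (cong (λ z → blksOut mNext true z Y) hf) (trans e3 (cong₂ _∷_ (cl-toBs cur fresh b) (clD-map fresh fresh bs))))

NxA-halt : ∀ h pre cbk → st cbk ≡ cur →
  macroEnd (config mNext nextInit (tape h (aroundCurrent pre cbk []) [])) ≡ halt' (acceptBlockList true (aroundCurrent pre cbk []))
NxA-halt h pre cbk sc with NX-CR-end false false true pre cbk sc
... | e1 , e2 = cong (endA mNext) (trans (cong (λ z → blksFin mNext false z (aroundCurrent pre cbk [])) (proj₂ (H-next nextInit h))) e2)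

NxB-halt : ∀ h c K k ts pre cbk → st cbk ≡ cur →
  macroEnd (config mNext nextInit (tape h (map (targetBlock done c K k) ts) (aroundCurrent pre cbk []))) ≡
  halt' (acceptBlockList (acceptBlockList true (map (targetBlock done c K k) ts)) (aroundCurrent pre cbk []))
NxB-halt h c K k ts pre cbk sc
  with NX-done false false false true (map (targetBlock done c K k) ts) (allStT done c K k ts)
... | e1 , e2 with NX-CR-end true false (acceptBlockList true (map (targetBlock done c K k) ts)) pre cbk sc
... | e3 , e4 = cong (endA mNext) (trans (cong (λ z → blksFin mNext true (blksFin mNext false z X) (aroundCurrent pre cbk [])) (proj₂ (H-next nextInit h)))
                  (trans (cong (λ z → blksFin mNext true z (aroundCurrent pre cbk [])) e2) e4))
  where
  X = map (targetBlock done c K k) ts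

Nx0-halt : ∀ h → macroEnd (config mNext nextInit (tape h [] [])) ≡ halt' true
Nx0-halt h = cong (endA mNext) (proj₂ (H-next nextInit h))

coverEachWith : List BlockData → List BlockData → List BlockData
coverEachWith [] ts = ts
coverEachWith (c ∷ cs) ts = coverEachWith cs (map (coverWith c) ts)

initS : BlockData → List BlockData → List BlockData
initS c [] = []
initS c (x ∷ xs) = c ∷ initS x xs

lastS : BlockData → List BlockData → BlockData
lastS c [] = c
lastS c (x ∷ xs) = lastS x xs

-- A Read and an Act sweep for each of the 3n bits of the current block.
stepsPerCurrent : ℕ → ℕ
stepsPerCurrent n = double n + (double n + double n)

stepsForCurrents : ℕ → List BlockData → ℕ
stepsForCurrents c6 [] = c6
stepsForCurrents c6 (x ∷ xs) = c6 + suc (stepsForCurrents c6 xs)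

macroSteps-after : ∀ a k c c1 → macroSteps a c ≡ just c1 → macroSteps (a + k) c ≡ macroSteps k c1
macroSteps-after a k c c1 e = trans (macroSteps-+ a k c) (cong (λ z → thenMacroSteps z k) e)

phaseA : ∀ n' post pre c ts → Shaped (suc n') c → All (Shaped (suc n')) post → All (Shaped (suc n')) ts →
  macroSteps (stepsForCurrents (stepsPerCurrent (suc n')) post) (config mRead (readInit fR false) (tape (replicate (suc n') false) (aroundCurrent pre (currentBlock 0 0 c) post) (map (toBs fresh) ts))) ≡
  just (config mNext nextInit (tape (replicate (suc n') true ++ []) (aroundCurrent (pre ++ initS c post) (currentBlock (suc n' + suc n') (suc n') (lastS c post)) [])
         (map (targetBlock fresh (lastS c post) (suc n' + suc n') (suc n')) (coverEachWith (initS c post) ts))))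
phaseA n' [] pre c ts lc lp lts =
  trans (processCurrent false n' pre [] c ts lc lts)
    (cong (λ z → just (config mNext nextInit (tape (replicate (suc n') true ++ []) (aroundCurrent z (currentBlock (suc n' + suc n') (suc n') c) [])
         (map (targetBlock fresh c (suc n' + suc n') (suc n')) ts)))) (sym (++-identityʳ pre)))
phaseA n' (c2 ∷ post) pre c ts lc lp lts =
  trans (macroSteps-after (stepsPerCurrent (suc n')) (suc (stepsForCurrents (stepsPerCurrent (suc n')) post))
           (config mRead (readInit fR false) (tape (replicate (suc n') false) (aroundCurrent pre (currentBlock 0 0 c) (c2 ∷ post)) (map (toBs fresh) ts))) _
           (processCurrent false n' pre (c2 ∷ post) c ts lc lts))
   (trans (macroSteps-after 1 (stepsForCurrents (stepsPerCurrent (suc n')) post)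
           (config mNext nextInit (tape (replicate (suc n') true ++ []) (aroundCurrent pre (currentBlock (suc n' + suc n') (suc n') c) (c2 ∷ post)) (map (targetBlock fresh c (suc n' + suc n') (suc n')) ts))) _
           (NxA-mid (suc n') pre c c2 post ts lc lts))
    (trans (phaseA n' post (pre ++ c ∷ []) c2 (map (coverWith c) ts) (All.head lp) (All.tail lp) (Shaped-map-coverWith (suc n') c ts lts))
      (cong (λ z → just (config mNext nextInit (tape (replicate (suc n') true ++ []) (aroundCurrent z (currentBlock (suc n' + suc n') (suc n') (lastS c2 post)) [])
         (map (targetBlock fresh (lastS c2 post) (suc n' + suc n') (suc n')) (coverEachWith (initS c2 post) (map (coverWith c) ts))))))
         (++-assoc pre (c ∷ []) (initS c2 post)))))

phaseB : ∀ n' post pre c ts → Shaped (suc n') c → All (Shaped (suc n')) post → All (Shaped (suc n')) ts →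
  macroSteps (stepsForCurrents (stepsPerCurrent (suc n')) post) (config mRead (readInit fR true) (tape (replicate (suc n') false) (map (toBs done) ts) (aroundCurrent pre (currentBlock 0 0 c) post))) ≡
  just (config mNext nextInit (tape (replicate (suc n') true ++ []) (map (targetBlock done (lastS c post) (suc n' + suc n') (suc n')) (coverEachWith (initS c post) ts))
         (aroundCurrent (pre ++ initS c post) (currentBlock (suc n' + suc n') (suc n') (lastS c post)) [])))
phaseB n' [] pre c ts lc lp lts =
  trans (processCurrent true n' pre [] c ts lc lts)
    (cong (λ z → just (config mNext nextInit (tape (replicate (suc n') true ++ []) (map (targetBlock done c (suc n' + suc n') (suc n')) ts)
         (aroundCurrent z (currentBlock (suc n' + suc n') (suc n') c) [])))) (sym (++-identityʳ pre)))
phaseB n' (c2 ∷ post) pre c ts lc lp lts =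
  trans (macroSteps-after (stepsPerCurrent (suc n')) (suc (stepsForCurrents (stepsPerCurrent (suc n')) post))
           (config mRead (readInit fR true) (tape (replicate (suc n') false) (map (toBs done) ts) (aroundCurrent pre (currentBlock 0 0 c) (c2 ∷ post)))) _
           (processCurrent true n' pre (c2 ∷ post) c ts lc lts))
   (trans (macroSteps-after 1 (stepsForCurrents (stepsPerCurrent (suc n')) post)
           (config mNext nextInit (tape (replicate (suc n') true ++ []) (map (targetBlock done c (suc n' + suc n') (suc n')) ts) (aroundCurrent pre (currentBlock (suc n' + suc n') (suc n') c) (c2 ∷ post)))) _
           (NxB-mid (suc n') pre c c2 post ts lc lts))
    (trans (phaseB n' post (pre ++ c ∷ []) c2 (map (coverWith c) ts) (All.head lp) (All.tail lp) (Shaped-map-coverWith (suc n') c ts lts))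
      (cong (λ z → just (config mNext nextInit (tape (replicate (suc n') true ++ []) (map (targetBlock done (lastS c2 post) (suc n' + suc n') (suc n')) (coverEachWith (initS c2 post) (map (coverWith c) ts)))
         (aroundCurrent z (currentBlock (suc n' + suc n') (suc n') (lastS c2 post)) []))))
         (++-assoc pre (c ∷ []) (initS c2 post)))))

coverWithAll : List BlockData → BlockData → BlockData
coverWithAll [] t = t
coverWithAll (c ∷ cs) t = coverWithAll cs (coverWith c t)

coverEachWith-∷ : ∀ cs x xs → coverEachWith cs (x ∷ xs) ≡ coverWithAll cs x ∷ coverEachWith cs xs
coverEachWith-∷ [] x xs = refl
coverEachWith-∷ (c ∷ cs) x xs = coverEachWith-∷ cs (coverWith c x) (map (coverWith c) xs)

coverEachWith-[] : ∀ cs → coverEachWith cs [] ≡ []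
coverEachWith-[] [] = refl
coverEachWith-[] (c ∷ cs) = coverEachWith-[] cs

coverEachWith-∷ʳ : ∀ cs y ts → coverEachWith (cs ++ y ∷ []) ts ≡ map (coverWith y) (coverEachWith cs ts)
coverEachWith-∷ʳ [] y ts = refl
coverEachWith-∷ʳ (c ∷ cs) y ts = coverEachWith-∷ʳ cs y (map (coverWith c) ts)

initS-lastS : ∀ c xs → initS c xs ++ lastS c xs ∷ [] ≡ c ∷ xs
initS-lastS c [] = refl
initS-lastS c (x ∷ xs) = cong (c ∷_) (initS-lastS x xs)

Shaped-lastS : ∀ n c xs → Shaped n c → All (Shaped n) xs → Shaped n (lastS c xs)
Shaped-lastS n c [] l [] = l
Shaped-lastS n c (x ∷ xs) l (lx ∷ lxs) = Shaped-lastS n x xs lx lxs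

Shaped-coverEachWith : ∀ n cs ts → All (Shaped n) ts → All (Shaped n) (coverEachWith cs ts)
Shaped-coverEachWith n [] ts l = l
Shaped-coverEachWith n (c ∷ cs) ts l = Shaped-coverEachWith n cs (map (coverWith c) ts) (Shaped-map-coverWith n c ts l)

Shaped-coverWithAll : ∀ n cs t → Shaped n t → Shaped n (coverWithAll cs t)
Shaped-coverWithAll n [] t l = l
Shaped-coverWithAll n (c ∷ cs) t l = Shaped-coverWithAll n cs (coverWith c t) (Shaped-coverWith n c t l)

acceptBlocks : Bool → List BlockData → Bool
acceptBlocks ac xs = acceptBlockList ac (map (toBs done) xs)

verdict : List BlockData → List BlockData → Bool
verdict As Bs = acceptBlocks (acceptBlocks true (coverEachWith (coverEachWith As Bs) As)) (coverEachWith As Bs)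

accC-clean : ∀ ac xs → acceptBits ac (map cleanB xs) ≡ acceptBits ac xs
accC-clean ac [] = refl
accC-clean ac (x ∷ xs) = accC-clean _ xs

accBs-clean : ∀ s ac xs → acceptBlockList ac (map (cleanBk s) xs) ≡ acceptBlockList ac xs
accBs-clean s ac [] = refl
accBs-clean s ac (x ∷ xs) rewrite accC-clean ac (q x) | accC-clean (acceptBits ac (q x)) (p x) = accBs-clean s _ xs

accBs-colT : ∀ s c n ac ts → Shaped n c → All (Shaped n) ts →
  acceptBlockList ac (map (targetBlock s c (n + n) n) ts) ≡ acceptBlocks ac (map (coverWith c) ts)
accBs-colT s c n ac ts lc lts =
  trans (sym (accBs-clean done ac (map (targetBlock s c (n + n) n) ts)))
    (cong (acceptBlockList ac) (trans (clT-map done s c n ts lc lts) refl))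

accBs-++ : ∀ ac xs ys → acceptBlockList ac (xs ++ ys) ≡ acceptBlockList (acceptBlockList ac xs) ys
accBs-++ ac [] ys = refl
accBs-++ ac (x ∷ xs) ys = accBs-++ (acceptBlock ac x) xs ys

accBs-CR : ∀ ac P K k c → acceptBlockList ac (aroundCurrent P (currentBlock K k c) []) ≡ acceptBlocks ac (P ++ c ∷ [])
accBs-CR ac P K k c =
  trans (sym (accBs-clean done ac (aroundCurrent P (currentBlock K k c) [])))
    (cong (acceptBlockList ac) (trans (map-++ (cleanBk done) (map (toBs done) P) (currentBlock K k c ∷ []))
      (trans (CRend-eq P c K k) refl)))

stepsForCurrents-closed : ∀ c xs → stepsForCurrents c xs ≡ suc (length xs) * c + length xs
stepsForCurrents-closed c [] = solve 1 (λ c → c := (con 1) :* c :+ con 0) refl c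
stepsForCurrents-closed c (x ∷ xs) rewrite stepsForCurrents-closed c xs = solve 2 (λ c l → c :+ (con 1 :+ ((con 1 :+ l) :* c :+ l)) := (con 2 :+ l) :* c :+ (con 1 :+ l)) refl c (length xs)

macroStepCount : ℕ → List BlockData → List BlockData → ℕ
macroStepCount n As Bs = (length As + length Bs) * (stepsPerCurrent n + 1)

initialTape : ℕ → List BlockData → List BlockData → Tape
initialTape n As Bs = tape (replicate n false) (map (toBs fresh) As) (map (toBs fresh) Bs)

HaltsWithVerdict : ℕ → List BlockData → List BlockData → Set
HaltsWithVerdict n As Bs = ∃ λ c' → macroSteps (macroStepCount n As Bs) (config mNext nextInit (initialTape n As Bs)) ≡ just c' × macroEnd c' ≡ halt' (verdict As Bs)

halts-with-verdict-[]-[] : ∀ n → HaltsWithVerdict n [] []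
halts-with-verdict-[]-[] n = config mNext nextInit (initialTape n [] []) , refl , Nx0-halt (replicate n false)

halts-with-verdict-A-[] : ∀ n' a As → Shaped (suc n') a → All (Shaped (suc n')) As → HaltsWithVerdict (suc n') (a ∷ As) []
halts-with-verdict-A-[] n' a As la las =
  _ , subst (λ z → macroSteps z (config mNext nextInit (initialTape n (a ∷ As) [])) ≡ just c') (sym keq)
        (trans (macroSteps-after 1 (stepsForCurrents (stepsPerCurrent n) As) (config mNext nextInit (initialTape n (a ∷ As) [])) _ (Nx0-A n a As []))
          (trans (phaseA n' As [] a [] la las [])
            (cong (λ z → just (config mNext nextInit (tape (replicate n true ++ []) (aroundCurrent (initS a As) (currentBlock (n + n) n (lastS a As)) [])
                  (map (targetBlock fresh (lastS a As) (n + n) n) z)))) (coverEachWith-[] (initS a As))))) ,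
      trans (NxA-halt (replicate n true ++ []) (initS a As) (currentBlock (n + n) n (lastS a As)) refl)
        (cong halt' (trans (accBs-CR true (initS a As) (n + n) n (lastS a As))
           (trans (cong (acceptBlocks true) (initS-lastS a As)) (sym (cong (λ z → acceptBlocks (acceptBlocks true (coverEachWith z (a ∷ As))) z) (coverEachWith-[] (a ∷ As)))))))
  where
  n = suc n'
  c' = config mNext nextInit (tape (replicate n true ++ []) (aroundCurrent (initS a As) (currentBlock (n + n) n (lastS a As)) []) [])
  keq : macroStepCount n (a ∷ As) [] ≡ 1 + stepsForCurrents (stepsPerCurrent n) As
  keq rewrite stepsForCurrents-closed (stepsPerCurrent n) As = solve 2 (λ l c → (con 1 :+ l :+ con 0) :* (c :+ con 1) := con 1 :+ ((con 1 :+ l) :* c :+ l)) refl (length As) (stepsPerCurrent n)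

halts-with-verdict-[]-B : ∀ n' b Bs → Shaped (suc n') b → All (Shaped (suc n')) Bs → HaltsWithVerdict (suc n') [] (b ∷ Bs)
halts-with-verdict-[]-B n' b Bs lb lbs =
  _ , subst (λ z → macroSteps z (config mNext nextInit (initialTape n [] (b ∷ Bs))) ≡ just c') (sym keq)
        (trans (macroSteps-after 1 (stepsForCurrents (stepsPerCurrent n) Bs) (config mNext nextInit (initialTape n [] (b ∷ Bs))) _ (Nx0-B n b Bs))
          (trans (phaseB n' Bs [] b [] lb lbs [])
            (cong (λ z → just (config mNext nextInit (tape (replicate n true ++ []) (map (targetBlock done (lastS b Bs) (n + n) n) z)
                  (aroundCurrent (initS b Bs) (currentBlock (n + n) n (lastS b Bs)) [])))) (coverEachWith-[] (initS b Bs))))) ,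
      trans (NxB-halt (replicate n true ++ []) (lastS b Bs) (n + n) n [] (initS b Bs) (currentBlock (n + n) n (lastS b Bs)) refl)
        (cong halt' (trans (accBs-CR true (initS b Bs) (n + n) n (lastS b Bs))
           (trans (cong (acceptBlocks true) (initS-lastS b Bs)) (cong (λ z → acceptBlocks (acceptBlocks true z) (b ∷ Bs)) (sym (coverEachWith-[] (b ∷ Bs)))))))
  where
  n = suc n'
  c' = config mNext nextInit (tape (replicate n true ++ []) [] (aroundCurrent (initS b Bs) (currentBlock (n + n) n (lastS b Bs)) []))
  keq : macroStepCount n [] (b ∷ Bs) ≡ 1 + stepsForCurrents (stepsPerCurrent n) Bs
  keq rewrite stepsForCurrents-closed (stepsPerCurrent n) Bs = solve 2 (λ l c → (con 1 :+ l) :* (c :+ con 1) := con 1 :+ ((con 1 :+ l) :* c :+ l)) refl (length Bs) (stepsPerCurrent n)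

length-coverEachWith : ∀ cs ts → length (coverEachWith cs ts) ≡ length ts
length-coverEachWith [] ts = refl
length-coverEachWith (c ∷ cs) ts = trans (length-coverEachWith cs (map (coverWith c) ts)) (length-map (coverWith c) ts)

module BothPhases (n' : ℕ) (a : BlockData) (As : List BlockData) (b : BlockData) (Bs : List BlockData)
  (la : Shaped (suc n') a) (las : All (Shaped (suc n')) As) (lb : Shaped (suc n') b) (lbs : All (Shaped (suc n')) Bs) where

  n KK : ℕ
  n = suc n'
  KK = n + n

  h : List Bool
  h = replicate n true ++ []

  lA t cB : BlockData
  lA = lastS a As
  t = coverWithAll (initS a As) b
  cB = coverWith lA t

  ts′ postB : List BlockData
  ts′ = coverEachWith (initS a As) Bs
  postB = map (coverWith lA) ts′

  lB : BlockData
  lB = lastS cB postB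

  Len-cB : Shaped n cB
  Len-cB = Shaped-coverWith n lA t (Shaped-coverWithAll n (initS a As) b lb)

  Len-postB : All (Shaped n) postB
  Len-postB = Shaped-map-coverWith n lA ts′ (Shaped-coverEachWith n (initS a As) Bs lbs)

  final : MacroConfig
  final = config mNext nextInit (tape h (map (targetBlock done lB KK n) (coverEachWith (initS cB postB) (a ∷ As))) (aroundCurrent (initS cB postB) (currentBlock KK n lB) []))

  coverEachWith-B : coverEachWith (a ∷ As) (b ∷ Bs) ≡ cB ∷ postB
  coverEachWith-B = trans (cong (λ z → coverEachWith z (b ∷ Bs)) (sym (initS-lastS a As)))
    (trans (coverEachWith-∷ʳ (initS a As) lA (b ∷ Bs)) (cong (map (coverWith lA)) (coverEachWith-∷ (initS a As) b Bs)))

  length-postB : length postB ≡ length Bs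
  length-postB = trans (length-map (coverWith lA) ts′) (length-coverEachWith (initS a As) Bs)

  steps-split : macroStepCount n (a ∷ As) (b ∷ Bs) ≡
    1 + (stepsForCurrents (stepsPerCurrent n) As + (1 + stepsForCurrents (stepsPerCurrent n) postB))
  steps-split rewrite stepsForCurrents-closed (stepsPerCurrent n) As | stepsForCurrents-closed (stepsPerCurrent n) postB | length-postB =
    solve 3 (λ x y c → (con 1 :+ x :+ (con 1 :+ y)) :* (c :+ con 1) := con 1 :+ (((con 1 :+ x) :* c :+ x) :+ (con 1 :+ ((con 1 :+ y) :* c :+ y))))
      refl (length As) (length Bs) (stepsPerCurrent n)

  reaches-final : macroSteps (macroStepCount n (a ∷ As) (b ∷ Bs)) (config mNext nextInit (initialTape n (a ∷ As) (b ∷ Bs))) ≡ just final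
  reaches-final = subst (λ z → macroSteps z (config mNext nextInit (initialTape n (a ∷ As) (b ∷ Bs))) ≡ just final) (sym steps-split)
    (trans (macroSteps-after 1 (stepsForCurrents (stepsPerCurrent n) As + (1 + stepsForCurrents (stepsPerCurrent n) postB)) (config mNext nextInit (initialTape n (a ∷ As) (b ∷ Bs))) _ (Nx0-A n a As (b ∷ Bs)))
    (trans (macroSteps-after (stepsForCurrents (stepsPerCurrent n) As) (1 + stepsForCurrents (stepsPerCurrent n) postB) _ _ (phaseA n' As [] a (b ∷ Bs) la las (lb ∷ lbs)))
    (trans (cong (λ z → macroSteps (1 + stepsForCurrents (stepsPerCurrent n) postB) (config mNext nextInit (tape h (aroundCurrent (initS a As) (currentBlock KK n lA) []) (map (targetBlock fresh lA KK n) z))))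
                 (coverEachWith-∷ (initS a As) b Bs))
    (trans (macroSteps-after 1 (stepsForCurrents (stepsPerCurrent n) postB) (config mNext nextInit (tape h (aroundCurrent (initS a As) (currentBlock KK n lA) []) (map (targetBlock fresh lA KK n) (t ∷ ts′)))) _
              (NxA-toB n (initS a As) lA t ts′ (Shaped-lastS n a As la las) (Shaped-coverWithAll n (initS a As) b lb ∷ Shaped-coverEachWith n (initS a As) Bs lbs)))
    (trans (cong (λ z → macroSteps (stepsForCurrents (stepsPerCurrent n) postB) (config mRead (readInit fR true) (tape (replicate n false) (map (toBs done) z) (aroundCurrent [] (currentBlock 0 0 cB) postB))))
                 (initS-lastS a As))
     (phaseB n' postB [] cB (a ∷ As) Len-cB Len-postB (la ∷ las)))))))

  final-halts : macroEnd final ≡ halt' (verdict (a ∷ As) (b ∷ Bs))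
  final-halts =
    trans (NxB-halt h lB KK n (coverEachWith (initS cB postB) (a ∷ As)) (initS cB postB) (currentBlock KK n lB) refl)
      (cong halt' (trans (cong (λ z → acceptBlockList z (aroundCurrent (initS cB postB) (currentBlock KK n lB) []))
          (trans (accBs-colT done lB n true (coverEachWith (initS cB postB) (a ∷ As)) (Shaped-lastS n cB postB Len-cB Len-postB)
                    (Shaped-coverEachWith n (initS cB postB) (a ∷ As) (la ∷ las)))
            (cong (acceptBlocks true) (trans (sym (coverEachWith-∷ʳ (initS cB postB) lB (a ∷ As))) (cong (λ z → coverEachWith z (a ∷ As)) (initS-lastS cB postB))))))
        (trans (accBs-CR (acceptBlocks true (coverEachWith (cB ∷ postB) (a ∷ As))) (initS cB postB) KK n lB)
          (trans (cong (λ z → acceptBlocks (acceptBlocks true (coverEachWith (cB ∷ postB) (a ∷ As))) z) (initS-lastS cB postB))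
            (sym (cong (λ z → acceptBlocks (acceptBlocks true (coverEachWith z (a ∷ As))) z) coverEachWith-B))))))

halts-with-verdict-A-B : ∀ n' a As b Bs → Shaped (suc n') a → All (Shaped (suc n')) As → Shaped (suc n') b → All (Shaped (suc n')) Bs →
  HaltsWithVerdict (suc n') (a ∷ As) (b ∷ Bs)
halts-with-verdict-A-B n' a As b Bs la las lb lbs = final , reaches-final , final-halts
  where open BothPhases n' a As b Bs la las lb lbs

unmarked : Bool → BitPair
unmarked v = (v , false)

blockOf : ∀ {n} → Reaction n → BlockData
blockOf a = blockData (map unmarked (toList (R a) ++ toList (I a))) (map unmarked (toList (P a)))

rawBits : List Bool → List Token
rawBits = map (λ v → tBit (mkBit v))

classify-header : ∀ n rest → clsAll PH (map inj₁ (replicate n b1) ++ rest) ≡ map tHdr (replicate n false) ++ clsAll PH rest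
classify-header zero rest = refl
classify-header (suc n) rest = cong (tHdr false ∷_) (classify-header n rest)

classify-bits : ∀ r xs rest → clsAll (bitPos r) (map inj₁ (map encBit xs) ++ rest) ≡ rawBits xs ++ clsAll (bitPos r) rest
classify-bits false [] rest = refl
classify-bits false (false ∷ xs) rest = cong (_ ∷_) (classify-bits false xs rest)
classify-bits false (true ∷ xs) rest = cong (_ ∷_) (classify-bits false xs rest)
classify-bits true [] rest = refl
classify-bits true (false ∷ xs) rest = cong (_ ∷_) (classify-bits true xs rest)
classify-bits true (true ∷ xs) rest = cong (_ ∷_) (classify-bits true xs rest)

rawB-eq : ∀ xs → map tBit (map bitOf (map unmarked xs)) ≡ rawBits xs
rawB-eq [] = refl
rawB-eq (x ∷ xs) = cong (_ ∷_) (rawB-eq xs)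

lead-cls : ∀ r rest → clsAll (startPos r) (inj₁ b1 ∷ rest) ≡ tLead fresh ∷ clsAll (bitPos r) rest
lead-cls false rest = refl
lead-cls true rest = refl

hash-cls : ∀ r rest → clsAll (bitPos r) (inj₁ hash ∷ rest) ≡ tHash ∷ clsAll (startPos r) rest
hash-cls false rest = refl
hash-cls true rest = refl

classify-encReaction : ∀ {n} r (a : Reaction n) rest → clsAll (startPos r) (map inj₁ (encReaction a) ++ rest) ≡ flatB (toBs fresh (blockOf a)) ++ clsAll (startPos r) rest
classify-encReaction r a rest =
  trans (lead-cls r _)
   (cong (tLead fresh ∷_)
    (trans (cong (clsAll (bitPos r)) (trans (cong (_++ rest) (map-++ inj₁ (encSubset (R a)) _)) (++-assoc (map inj₁ (encSubset (R a))) _ rest)))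
    (trans (classify-bits r (toList (R a)) _)
    (trans (cong (rawBits (toList (R a)) ++_) (trans (cong (clsAll (bitPos r)) (trans (cong (_++ rest) (map-++ inj₁ (encSubset (I a)) _)) (++-assoc (map inj₁ (encSubset (I a))) _ rest))) (classify-bits r (toList (I a)) _)))
    (trans (cong (λ z → rawBits (toList (R a)) ++ (rawBits (toList (I a)) ++ z))
              (trans (cong (clsAll (bitPos r)) (trans (cong (_++ rest) (map-++ inj₁ (encSubset (P a)) _)) (++-assoc (map inj₁ (encSubset (P a))) _ rest)))
                (trans (classify-bits r (toList (P a)) _) (cong (rawBits (toList (P a)) ++_) (hash-cls r rest)))))
      (sym eqF))))))
  where
  sqs = map unmarked (toList (R a) ++ toList (I a))
  sps = map unmarked (toList (P a))
  eqF : (map tBit (map bitOf sqs ++ map bitOf sps) ++ (tHash ∷ [])) ++ clsAll (startPos r) rest ≡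
        rawBits (toList (R a)) ++ (rawBits (toList (I a)) ++ (rawBits (toList (P a)) ++ (tHash ∷ clsAll (startPos r) rest)))
  eqF = trans (++-assoc (map tBit (map bitOf sqs ++ map bitOf sps)) (tHash ∷ []) (clsAll (startPos r) rest)) (trans (cong (λ z → z ++ (tHash ∷ []) ++ clsAll (startPos r) rest)
           (trans (map-++ tBit (map bitOf sqs) (map bitOf sps))
             (cong₂ _++_ (trans (cong (map tBit) (trans (cong (map bitOf) (map-++ unmarked (toList (R a)) (toList (I a))))
                                                   (map-++ bitOf (map unmarked (toList (R a))) (map unmarked (toList (I a))))))
                                (trans (map-++ tBit (map bitOf (map unmarked (toList (R a)))) (map bitOf (map unmarked (toList (I a)))))
                                  (cong₂ _++_ (rawB-eq (toList (R a))) (rawB-eq (toList (I a))))))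
                          (rawB-eq (toList (P a))))))
        (trans (++-assoc (rawBits (toList (R a)) ++ rawBits (toList (I a))) (rawBits (toList (P a))) _)
          (trans (++-assoc (rawBits (toList (R a))) (rawBits (toList (I a))) _) refl)))

classify-concatMap-encReaction : ∀ {n} r (As : List (Reaction n)) rest →
  clsAll (startPos r) (map inj₁ (concatMap encReaction As) ++ rest) ≡ flatBs (map (toBs fresh) (map blockOf As)) ++ clsAll (startPos r) rest
classify-concatMap-encReaction r [] rest = refl
classify-concatMap-encReaction r (a ∷ As) rest =
  trans (cong (clsAll (startPos r)) (trans (cong (_++ rest) (map-++ inj₁ (encReaction a) (concatMap encReaction As)))
                                       (++-assoc (map inj₁ (encReaction a)) _ rest)))
   (trans (classify-encReaction r a _)
    (trans (cong (flatB (toBs fresh (blockOf a)) ++_) (classify-concatMap-encReaction r As rest))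
      (sym (++-assoc (flatB (toBs fresh (blockOf a))) (flatBs (map (toBs fresh) (map blockOf As))) _))))

classify-encInstance : ∀ n (A B : List (Reaction n)) → clsAll PH (map inj₁ (encInstance n A B)) ≡ flatT (initialTape n (map blockOf A) (map blockOf B))
classify-encInstance n A B =
  trans (cong (clsAll PH) (map-++ inj₁ (replicate n b1) (hash ∷ concatMap encReaction A ++ hash ∷ concatMap encReaction B)))
   (trans (classify-header n _)
    (cong (map tHdr (replicate n false) ++_)
     (cong (tHash ∷_)
      (trans (cong (clsAll PA0) (map-++ inj₁ (concatMap encReaction A) (hash ∷ concatMap encReaction B)))
       (trans (classify-concatMap-encReaction false A _)
        (cong (flatBs (map (toBs fresh) (map blockOf A)) ++_)
          (cong (tHash ∷_) (trans (cong (clsAll PB0) (sym (++-identityʳ (map inj₁ (concatMap encReaction B)))))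
            (trans (classify-concatMap-encReaction true B []) (++-identityʳ _))))))))))

Shaped-blockOf : ∀ {n} (a : Reaction n) → Shaped n (blockOf a)
Shaped-blockOf {n} a =
  trans (length-map unmarked (toList (R a) ++ toList (I a))) (trans (length-++ (toList (R a))) (cong₂ _+_ (length-toList (R a)) (length-toList (I a)))) ,
  trans (length-map unmarked (toList (P a))) (length-toList (P a))

Shaped-map-blockOf : ∀ {n} (A : List (Reaction n)) → All (Shaped n) (map blockOf A)
Shaped-map-blockOf [] = []
Shaped-map-blockOf (a ∷ A) = Shaped-blockOf a ∷ Shaped-map-blockOf A

halts-with-verdict : ∀ n (A B : List (Reaction n)) → IsReactionSystem A → IsReactionSystem B → HaltsWithVerdict n (map blockOf A) (map blockOf B)
halts-with-verdict zero [] [] _ _ = halts-with-verdict-[]-[] zero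
halts-with-verdict zero (a ∷ A) B (ia ∷ _) _ with ia
... | () , _
halts-with-verdict zero [] (b ∷ B) _ (ib ∷ _) with ib
... | () , _
halts-with-verdict (suc n') [] [] _ _ = halts-with-verdict-[]-[] (suc n')
halts-with-verdict (suc n') (a ∷ A) [] _ _ = halts-with-verdict-A-[] n' (blockOf a) (map blockOf A) (Shaped-blockOf a) (Shaped-map-blockOf A)
halts-with-verdict (suc n') [] (b ∷ B) _ _ = halts-with-verdict-[]-B n' (blockOf b) (map blockOf B) (Shaped-blockOf b) (Shaped-map-blockOf B)
halts-with-verdict (suc n') (a ∷ A) (b ∷ B) _ _ = halts-with-verdict-A-B n' (blockOf a) (map blockOf A) (blockOf b) (map blockOf B) (Shaped-blockOf a) (Shaped-map-blockOf A) (Shaped-blockOf b) (Shaped-map-blockOf B)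

initA-at : ∀ w → initA w ≡ at startState [] (map just (map inj₁ w) ++ [])
initA-at [] = refl
initA-at (s ∷ w) = cong (cA startState [] (just (inj₁ s))) (sym (trans (++-identityʳ _) (eq w)))
  where
  eq : ∀ w → map just (map inj₁ w) ≡ map (λ y → just (inj₁ y)) w
  eq [] = refl
  eq (x ∷ w) = cong (_ ∷_) (eq w)

blockLength : ℕ → ℕ
blockLength n = suc (n + (n + (n + 1)))

length-encReaction : ∀ {n} (a : Reaction n) → length (encReaction a) ≡ blockLength n
length-encReaction {n} a = cong suc (trans (length-++ (encSubset (R a)))
  (cong₂ _+_ (trans (length-map encBit (toList (R a))) (length-toList (R a)))
    (trans (length-++ (encSubset (I a)))
      (cong₂ _+_ (trans (length-map encBit (toList (I a))) (length-toList (I a)))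
        (trans (length-++ (encSubset (P a))) (cong (_+ 1) (trans (length-map encBit (toList (P a))) (length-toList (P a)))))))))

length-concatMap-encReaction : ∀ {n} (A : List (Reaction n)) → length (concatMap encReaction A) ≡ length A * blockLength n
length-concatMap-encReaction [] = refl
length-concatMap-encReaction (a ∷ A) = trans (length-++ (encReaction a)) (cong₂ _+_ (length-encReaction a) (length-concatMap-encReaction A))

length-encInstance : ∀ n (A B : List (Reaction n)) → length (encInstance n A B) ≡ n + suc (length A * blockLength n + suc (length B * blockLength n))
length-encInstance n A B = trans (length-++ (replicate n b1)) (cong₂ _+_ (length-replicate n)
  (cong suc (trans (length-++ (concatMap encReaction A)) (cong₂ _+_ (length-concatMap-encReaction A) (cong suc (length-concatMap-encReaction B))))))

double≡+ : ∀ n → double n ≡ n + n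
double≡+ zero = refl
double≡+ (suc n) = cong suc (trans (cong suc (double≡+ n)) (sym (+-suc n n)))

macroStepCount-bound : ∀ n (A B : List (Reaction n)) → ∃ λ e → macroStepCount n (map blockOf A) (map blockOf B) + e ≡ length (encInstance n A B) + length (encInstance n A B)
macroStepCount-bound n A B = (n + n + 4 + 3 * (length A + length B)) ,
  (begin
    (length (map blockOf A) + length (map blockOf B)) * (double n + (double n + double n) + 1) + (n + n + 4 + 3 * (length A + length B))
      ≡⟨ cong (λ z → z + (n + n + 4 + 3 * (length A + length B))) (cong₂ _*_ (cong₂ _+_ (length-map blockOf A) (length-map blockOf B))
             (cong (_+ 1) (cong₂ _+_ (double≡+ n) (cong₂ _+_ (double≡+ n) (double≡+ n))))) ⟩
    (length A + length B) * (n + n + (n + n + (n + n)) + 1) + (n + n + 4 + 3 * (length A + length B))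
      ≡⟨ solve 3 (λ n a b → (a :+ b) :* (n :+ n :+ (n :+ n :+ (n :+ n)) :+ con 1) :+ (n :+ n :+ con 4 :+ con 3 :* (a :+ b))
                     := (n :+ (con 1 :+ (a :* (con 1 :+ (n :+ (n :+ (n :+ con 1)))) :+ (con 1 :+ b :* (con 1 :+ (n :+ (n :+ (n :+ con 1))))))))
                      :+ (n :+ (con 1 :+ (a :* (con 1 :+ (n :+ (n :+ (n :+ con 1)))) :+ (con 1 :+ b :* (con 1 :+ (n :+ (n :+ (n :+ con 1))))))))) refl n (length A) (length B) ⟩
    (n + suc (length A * blockLength n + suc (length B * blockLength n))) + (n + suc (length A * blockLength n + suc (length B * blockLength n)))
      ≡⟨ sym (cong₂ _+_ (length-encInstance n A B) (length-encInstance n A B)) ⟩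
    length (encInstance n A B) + length (encInstance n A B) ∎)
  where open ≡-Reasoning

fuel-split : ∀ L k e → k + e ≡ L + L → 4 * (L + 1) ^ 2 ≡ k * roundTrip L + (L + suc (e * roundTrip L + (L + L + L + 3)))
fuel-split L k e h =
  trans (solve 1 (λ L → con 4 :* ((L :+ con 1) :^ 2) := (L :+ L) :* (con 2 :+ (L :+ L)) :+ (L :+ (con 1 :+ (L :+ L :+ L :+ con 3)))) refl L)
   (trans (cong (λ z → z * roundTrip L + (L + suc (L + L + L + 3))) (sym h))
     (solve 4 (λ k e P L → (k :+ e) :* P :+ (L :+ (con 1 :+ (L :+ L :+ L :+ con 3))) := k :* P :+ (L :+ (con 1 :+ (e :* P :+ (L :+ L :+ L :+ con 3))))) refl k e (roundTrip L) L))

M-halts-with-verdict : ∀ n (A B : List (Reaction n)) → IsReactionSystem A → IsReactionSystem B →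
  HaltsWithin M (4 * (length (encInstance n A B) + 1) ^ 2) (encInstance n A B) (verdict (map blockOf A) (map blockOf B))
M-halts-with-verdict n A B iA iB with halts-with-verdict n A B iA iB | macroStepCount-bound n A B
... | c' , it , he | e , ke =
  trans (cong (λ z → run M z (initConfig M w)) (fuel-split L k e ke))
   (trans (cong (run M T) (initConfig-encode w))
    (trans (run-simulates T (initA w))
     (trans (cong (runA T) (initA-at w))
       (subst (λ z → runA (k * roundTrip z + (z + suc f)) (at startState [] (map just cs ++ [])) ≡ just b) (length-map inj₁ w)
          (run-macroSteps k (initialTape n (map blockOf A) (map blockOf B)) mNext nextInit c' b cs [] [] f (classify-encInstance n A B) refl refl it he)))))
  where
  w = encInstance n A B
  cs = map inj₁ w
  L = length w
  k = macroStepCount n (map blockOf A) (map blockOf B)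
  b = verdict (map blockOf A) (map blockOf B)
  f = e * roundTrip L + (L + L + L + 3)
  T = k * roundTrip L + (L + suc f)

bitsImply : List Bool → List Bool → Bool
bitsImply [] _ = true
bitsImply (c ∷ cs) [] = true
bitsImply (c ∷ cs) (t ∷ ts) = implies c t ∧ bitsImply cs ts

vals : List BitPair → List Bool
vals = map proj₁

okQ-vals : ∀ cs ts → okQ cs ts ≡ bitsImply (vals cs) (vals ts)
okQ-vals [] ts = refl
okQ-vals (c ∷ cs) [] = refl
okQ-vals (c ∷ cs) (t ∷ ts) = cong (implies (proj₁ c) (proj₁ t) ∧_) (okQ-vals cs ts)

updP-v : ∀ ok cs ts → vals (coverProducts ok cs ts) ≡ vals ts
updP-v ok [] ts = refl
updP-v ok (c ∷ cs) [] = refl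
updP-v ok (c ∷ cs) (t ∷ ts) = cong (proj₁ t ∷_) (updP-v ok cs ts)

updP-c : ∀ ok cs cs' ts → vals cs ≡ vals cs' → coverProducts ok cs ts ≡ coverProducts ok cs' ts
updP-c ok [] [] ts e = refl
updP-c ok (c ∷ cs) (c' ∷ cs') [] e = refl
updP-c ok (c ∷ cs) (c' ∷ cs') (t ∷ ts) e =
  cong₂ _∷_ (cong (λ z → (proj₁ t , proj₂ t ∨ (ok ∧ z))) (∷-injectiveˡ e)) (updP-c ok cs cs' ts (∷-injectiveʳ e))

updQ-v : ∀ ts → vals (coverGuards ts) ≡ vals ts
updQ-v [] = refl
updQ-v (t ∷ ts) = cong (proj₁ t ∷_) (updQ-v ts)

guardValues : BlockData → List Bool
guardValues t = vals (sq t)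

productValues : BlockData → List Bool
productValues t = vals (sp t)

updT-c : ∀ c c' t → guardValues c ≡ guardValues c' → productValues c ≡ productValues c' → coverWith c t ≡ coverWith c' t
updT-c c c' t e1 e2 = cong (blockData (coverGuards (sq t)))
  (trans (cong (λ z → coverProducts z (sp c) (sp t)) (trans (okQ-vals (sq c) (sq t)) (trans (cong (λ z → bitsImply z (guardValues t)) e1) (sym (okQ-vals (sq c') (sq t))))))
         (updP-c _ (sp c) (sp c') (sp t) e2))

updAll-VQ : ∀ cs t → guardValues (coverWithAll cs t) ≡ guardValues t
updAll-VQ [] t = refl
updAll-VQ (c ∷ cs) t = trans (updAll-VQ cs (coverWith c t)) (updQ-v (sq t))

updAll-VP : ∀ cs t → productValues (coverWithAll cs t) ≡ productValues t
updAll-VP [] t = refl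
updAll-VP (c ∷ cs) t = trans (updAll-VP cs (coverWith c t)) (updP-v _ (sp c) (sp t))

updAll-c : ∀ cs cs' t → map guardValues cs ≡ map guardValues cs' → map productValues cs ≡ map productValues cs' → coverWithAll cs t ≡ coverWithAll cs' t
updAll-c [] [] t e1 e2 = refl
updAll-c (c ∷ cs) (c' ∷ cs') t e1 e2 =
  trans (cong (coverWithAll cs) (updT-c c c' t (∷-injectiveˡ e1) (∷-injectiveˡ e2))) (updAll-c cs cs' (coverWith c' t) (∷-injectiveʳ e1) (∷-injectiveʳ e2))

coverEachWith≡map : ∀ cs ts → coverEachWith cs ts ≡ map (coverWithAll cs) ts
coverEachWith≡map [] ts = sym (map-id ts)
coverEachWith≡map (c ∷ cs) ts = trans (coverEachWith≡map cs (map (coverWith c) ts)) (sym (map-∘ ts))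

mapVQ : ∀ As Bs → map guardValues (map (coverWithAll As) Bs) ≡ map guardValues Bs
mapVQ As [] = refl
mapVQ As (b ∷ Bs) = cong₂ _∷_ (updAll-VQ As b) (mapVQ As Bs)

mapVP : ∀ As Bs → map productValues (map (coverWithAll As) Bs) ≡ map productValues Bs
mapVP As [] = refl
mapVP As (b ∷ Bs) = cong₂ _∷_ (updAll-VP As b) (mapVP As Bs)

allCovered : List BitPair → Bool
allCovered [] = true
allCovered (x ∷ xs) = implies (proj₁ x) (proj₂ x) ∧ allCovered xs

blockOk : BlockData → Bool
blockOk t = allCovered (sq t) ∧ allCovered (sp t)

allBlocksOk : List BlockData → Bool
allBlocksOk [] = true
allBlocksOk (t ∷ ts) = blockOk t ∧ allBlocksOk ts

accC-cln : ∀ ac xs → acceptBits ac (map bitOf xs) ≡ ac ∧ allCovered xs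
accC-cln ac [] = sym (∧-identityʳ ac)
accC-cln ac (x ∷ xs) = trans (accC-cln (ac ∧ implies (proj₁ x) (proj₂ x)) xs) (∧-assoc ac _ _)

accS-all : ∀ ac xs → acceptBlocks ac xs ≡ ac ∧ allBlocksOk xs
accS-all ac [] = sym (∧-identityʳ ac)
accS-all ac (x ∷ xs) =
  trans (cong (λ z → acceptBlockList z (map (toBs done) xs))
          (trans (cong (λ z → acceptBits z (map bitOf (sp x))) (accC-cln ac (sq x))) (trans (accC-cln (ac ∧ allCovered (sq x)) (sp x)) (∧-assoc ac _ _))))
    (trans (accS-all (ac ∧ blockOk x) xs) (∧-assoc ac (blockOk x) (allBlocksOk xs)))

verdict-split : ∀ As Bs → verdict As Bs ≡ allBlocksOk (map (coverWithAll Bs) As) ∧ allBlocksOk (map (coverWithAll As) Bs)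
verdict-split As Bs =
  trans (accS-all _ (coverEachWith As Bs))
    (cong₂ _∧_ (trans (accS-all true (coverEachWith (coverEachWith As Bs) As))
                  (trans (cong allBlocksOk (coverEachWith≡map (coverEachWith As Bs) As))
                    (cong allBlocksOk (map-cong (λ t → updAll-c (coverEachWith As Bs) Bs t
                       (trans (cong (map guardValues) (coverEachWith≡map As Bs)) (mapVQ As Bs))
                       (trans (cong (map productValues) (coverEachWith≡map As Bs)) (mapVP As Bs))) As))))
               (cong allBlocksOk (coverEachWith≡map As Bs)))

guardsImply : ∀ {n} → Reaction n → Reaction n → Bool
guardsImply c a = bitsImply (toList (R c) ++ toList (I c)) (toList (R a) ++ toList (I a))

coverProductsV : ∀ {n} → Bool → Vec BitPair n → Vec BitPair n → Vec BitPair n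
coverProductsV ok cv tv = zipWith (λ c t → (proj₁ t , proj₂ t ∨ (ok ∧ proj₁ c))) cv tv

coverAllV : ∀ {n} → List (Reaction n) → Reaction n → Vec BitPair n → Vec BitPair n
coverAllV [] a tv = tv
coverAllV (c ∷ cs) a tv = coverAllV cs a (coverProductsV (guardsImply c a) (V.map unmarked (P c)) tv)

vals-pair : ∀ xs → vals (map unmarked xs) ≡ xs
vals-pair [] = refl
vals-pair (x ∷ xs) = cong (x ∷_) (vals-pair xs)

updP-toList : ∀ {n} ok (cv tv : Vec BitPair n) → coverProducts ok (toList cv) (toList tv) ≡ toList (coverProductsV ok cv tv)
updP-toList ok [] [] = refl
updP-toList ok (c ∷ cv) (t ∷ tv) = cong (_ ∷_) (updP-toList ok cv tv)

sp-upd : ∀ {n} (a : Reaction n) cs t (tv : Vec BitPair n) → sp t ≡ toList tv → guardValues t ≡ guardValues (blockOf a) →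
  sp (coverWithAll (map blockOf cs) t) ≡ toList (coverAllV cs a tv)
sp-upd a [] t tv e1 e2 = e1
sp-upd a (c ∷ cs) t tv e1 e2 =
  sp-upd a cs (coverWith (blockOf c) t) (coverProductsV (guardsImply c a) (V.map unmarked (P c)) tv) eq (trans (updQ-v (sq t)) e2)
  where
  okeq : okQ (sq (blockOf c)) (sq t) ≡ guardsImply c a
  okeq = trans (okQ-vals (sq (blockOf c)) (sq t))
           (cong₂ bitsImply (vals-pair (toList (R c) ++ toList (I c))) (trans e2 (vals-pair (toList (R a) ++ toList (I a)))))
  eq : sp (coverWith (blockOf c) t) ≡ toList (coverProductsV (guardsImply c a) (V.map unmarked (P c)) tv)
  eq = trans (cong₂ (λ z w → coverProducts z (map unmarked (toList (P c))) w) okeq e1)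
         (trans (cong (λ z → coverProducts (guardsImply c a) z (toList tv)) (sym (toList-map unmarked (P c))))
           (updP-toList (guardsImply c a) (V.map unmarked (P c)) tv))

updQ-idem : ∀ xs → coverGuards (coverGuards xs) ≡ coverGuards xs
updQ-idem [] = refl
updQ-idem (x ∷ xs) = cong (_ ∷_) (updQ-idem xs)

sq-upd : ∀ c cs t → sq (coverWithAll (c ∷ cs) t) ≡ coverGuards (sq t)
sq-upd c [] t = refl
sq-upd c (c2 ∷ cs) t = trans (sq-upd c2 cs (coverWith c t)) (updQ-idem (sq t))

implies-true : ∀ x → implies x true ≡ true
implies-true false = refl
implies-true true = refl

allCovered-coverGuards : ∀ xs → allCovered (coverGuards xs) ≡ true
allCovered-coverGuards [] = refl
allCovered-coverGuards (x ∷ xs) rewrite implies-true (proj₁ x) = allCovered-coverGuards xs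

lk-upd1 : ∀ {n} (a : Reaction n) cs (tv : Vec BitPair n) x → proj₁ (lookup (coverAllV cs a tv) x) ≡ proj₁ (lookup tv x)
lk-upd1 a [] tv x = refl
lk-upd1 a (c ∷ cs) tv x = trans (lk-upd1 a cs _ x) (lk x (V.map unmarked (P c)) tv)
  where
  lk : ∀ {n} x (cv tv : Vec BitPair n) → proj₁ (lookup (coverProductsV (guardsImply c a) cv tv) x) ≡ proj₁ (lookup tv x)
  lk zero (_ ∷ _) (_ ∷ _) = refl
  lk (suc x) (_ ∷ cv) (_ ∷ tv) = lk x cv tv

lk-zw : ∀ {n} ok x (cv tv : Vec BitPair n) → proj₂ (lookup (coverProductsV ok cv tv) x) ≡ proj₂ (lookup tv x) ∨ (ok ∧ proj₁ (lookup cv x))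
lk-zw ok zero (_ ∷ _) (_ ∷ _) = refl
lk-zw ok (suc x) (_ ∷ cv) (_ ∷ tv) = lk-zw ok x cv tv

lk-pair : ∀ {n} x (v : Vec Bool n) → lookup (V.map unmarked v) x ≡ unmarked (lookup v x)
lk-pair zero (_ ∷ _) = refl
lk-pair (suc x) (_ ∷ v) = lk-pair x v

∨-true : ∀ a b → a ∨ b ≡ true → a ≡ true ⊎ b ≡ true
∨-true true b e = inj₁ refl
∨-true false b e = inj₂ e

lk-upd2 : ∀ {n} (a : Reaction n) cs (tv : Vec BitPair n) x → proj₂ (lookup (coverAllV cs a tv) x) ≡ true →
  proj₂ (lookup tv x) ≡ true ⊎ Any (λ c → guardsImply c a ≡ true × lookup (P c) x ≡ true) cs
lk-upd2 a [] tv x e = inj₁ e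
lk-upd2 a (c ∷ cs) tv x e with lk-upd2 a cs _ x e
... | inj₂ an = inj₂ (there an)
... | inj₁ e' with ∨-true _ _ (trans (sym (lk-zw (guardsImply c a) x (V.map unmarked (P c)) tv)) e')
...   | inj₁ e2 = inj₁ e2
...   | inj₂ e3 = inj₂ (here (∧-conicalˡ _ _ e3 , trans (sym (cong proj₁ (lk-pair x (P c)))) (∧-conicalʳ _ _ e3)))

lk-upd3 : ∀ {n} (a : Reaction n) cs (tv : Vec BitPair n) x →
  (proj₂ (lookup tv x) ≡ true ⊎ Any (λ c → guardsImply c a ≡ true × lookup (P c) x ≡ true) cs) → proj₂ (lookup (coverAllV cs a tv) x) ≡ true
lk-upd3 a [] tv x (inj₁ e) = e
lk-upd3 a [] tv x (inj₂ ())
lk-upd3 a (c ∷ cs) tv x (inj₁ e) = lk-upd3 a cs _ x (inj₁ (trans (lk-zw (guardsImply c a) x (V.map unmarked (P c)) tv) (cong (_∨ _) e)))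
lk-upd3 a (c ∷ cs) tv x (inj₂ (here (e1 , e2))) =
  lk-upd3 a cs _ x (inj₁ (trans (lk-zw (guardsImply c a) x (V.map unmarked (P c)) tv)
    (trans (cong (λ z → proj₂ (lookup tv x) ∨ (guardsImply c a ∧ z)) (trans (cong proj₁ (lk-pair x (P c))) e2))
      (trans (cong (λ z → proj₂ (lookup tv x) ∨ (z ∧ true)) e1) (∨-zeroʳ _)))))
lk-upd3 a (c ∷ cs) tv x (inj₂ (there an)) = lk-upd3 a cs _ x (inj₂ an)

allCovered⇒implies : ∀ {n} (v : Vec BitPair n) → allCovered (toList v) ≡ true → ∀ x → implies (proj₁ (lookup v x)) (proj₂ (lookup v x)) ≡ true
allCovered⇒implies (y ∷ v) e zero = ∧-conicalˡ _ _ e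
allCovered⇒implies (y ∷ v) e (suc x) = allCovered⇒implies v (∧-conicalʳ _ _ e) x

implies⇒allCovered : ∀ {n} (v : Vec BitPair n) → (∀ x → implies (proj₁ (lookup v x)) (proj₂ (lookup v x)) ≡ true) → allCovered (toList v) ≡ true
implies⇒allCovered [] h = refl
implies⇒allCovered (y ∷ v) h rewrite h zero = implies⇒allCovered v (λ x → h (suc x))

bitsImply-++ : ∀ xs ys xs′ ys′ → length xs ≡ length xs′ →
  bitsImply (xs ++ ys) (xs′ ++ ys′) ≡ bitsImply xs xs′ ∧ bitsImply ys ys′
bitsImply-++ [] ys [] ys′ e = refl
bitsImply-++ (x ∷ xs) ys (x′ ∷ xs′) ys′ e =
  trans (cong (implies x x′ ∧_) (bitsImply-++ xs ys xs′ ys′ (cong pred e))) (sym (∧-assoc (implies x x′) _ _))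

bitsImply-⊥ : ∀ {n} (w : Subset n) → bitsImply (toList (⊥ {n})) (toList w) ≡ true
bitsImply-⊥ [] = refl
bitsImply-⊥ (x ∷ w) = bitsImply-⊥ w

bitsImply⇒⊆ : ∀ {n} (u w : Subset n) → bitsImply (toList u) (toList w) ≡ true → u ⊆ w
bitsImply⇒⊆ (true ∷ u) (true ∷ w) e V.here = V.here
bitsImply⇒⊆ (s ∷ u) (t ∷ w) e (V.there x∈u) = V.there (bitsImply⇒⊆ u w (∧-conicalʳ (implies s t) _ e) x∈u)

⊆⇒bitsImply : ∀ {n} (u w : Subset n) → u ⊆ w → bitsImply (toList u) (toList w) ≡ true
⊆⇒bitsImply [] [] u⊆w = refl
⊆⇒bitsImply (false ∷ u) (t ∷ w) u⊆w = ⊆⇒bitsImply u w (drop-∷-⊆ u⊆w)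
⊆⇒bitsImply (true ∷ u) (true ∷ w) u⊆w = ⊆⇒bitsImply u w (drop-∷-⊆ u⊆w)
⊆⇒bitsImply (true ∷ u) (false ∷ w) u⊆w = contradiction (u⊆w V.here) λ ()

guardsImply-split : ∀ {n} (c a : Reaction n) →
  guardsImply c a ≡ bitsImply (toList (R c)) (toList (R a)) ∧ bitsImply (toList (I c)) (toList (I a))
guardsImply-split c a =
  bitsImply-++ (toList (R c)) (toList (I c)) (toList (R a)) (toList (I a))
    (trans (length-toList (R c)) (sym (length-toList (R a))))

guardsImply⇒⊆ : ∀ {n} (c a : Reaction n) → guardsImply c a ≡ true → I c ⊆ I a
guardsImply⇒⊆ c a e = bitsImply⇒⊆ (I c) (I a) (∧-conicalʳ _ _ (trans (sym (guardsImply-split c a)) e))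

⊆⇒guardsImply : ∀ {n} (c a : Reaction n) → R c ≡ ⊥ → I c ⊆ I a → guardsImply c a ≡ true
⊆⇒guardsImply c a Rc≡⊥ Ic⊆Ia = begin
  guardsImply c a                                                         ≡⟨ guardsImply-split c a ⟩
  bitsImply (toList (R c)) (toList (R a)) ∧ bitsImply (toList (I c)) (toList (I a))
    ≡⟨ cong₂ _∧_ (trans (cong (λ r → bitsImply (toList r) (toList (R a))) Rc≡⊥) (bitsImply-⊥ (R a)))
                 (⊆⇒bitsImply (I c) (I a) Ic⊆Ia) ⟩
  true                                                                    ∎
  where open ≡-Reasoning

implies-intro : ∀ b y → (b ≡ true → y ≡ true) → implies b y ≡ true
implies-intro false y h = refl
implies-intro true y h = h refl

implies-elim : ∀ b y → implies b y ≡ true → b ≡ true → y ≡ true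
implies-elim true y e refl = e

∧-intro : ∀ {a b} → a ≡ true → b ≡ true → a ∧ b ≡ true
∧-intro refl refl = refl

blockOk⇒covered : ∀ {n} (Cs : ReactionSystem n) (a : Reaction n) →
  blockOk (coverWithAll (map blockOf Cs) (blockOf a)) ≡ true → CoveredBy Cs a
blockOk⇒covered Cs a ok {x} x∈Pa =
  Any.map (λ { {c} (okc , x∈Pc) → (λ {y} → guardsImply⇒⊆ c a okc {y}) , lookup⇒[]= x (P c) x∈Pc }) coverer
  where
  tv = V.map unmarked (P a)
  V′ = coverAllV Cs a tv
  covered-in-V′ : allCovered (toList V′) ≡ true
  covered-in-V′ = trans (cong allCovered (sym (sp-upd a Cs (blockOf a) tv (sym (toList-map unmarked (P a))) refl)))
                        (∧-conicalʳ _ _ ok)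
  x-in-V′ : proj₁ (lookup V′ x) ≡ true
  x-in-V′ = trans (lk-upd1 a Cs tv x) (trans (cong proj₁ (lk-pair x (P a))) ([]=⇒lookup x∈Pa))
  x-covered : proj₂ (lookup V′ x) ≡ true
  x-covered = implies-elim _ _ (allCovered⇒implies V′ covered-in-V′ x) x-in-V′
  coverer : Any (λ c → guardsImply c a ≡ true × lookup (P c) x ≡ true) Cs
  coverer with lk-upd2 a Cs tv x x-covered
  ... | inj₂ r = r
  ... | inj₁ r with trans (sym (cong proj₂ (lk-pair x (P a)))) r
  ... | ()

covered⇒blockOk : ∀ {n} (Cs : ReactionSystem n) (a : Reaction n) → Reactantless Cs → IsReaction a →
  CoveredBy Cs a → blockOk (coverWithAll (map blockOf Cs) (blockOf a)) ≡ true
covered⇒blockOk Cs a rCs (x₀ , x₀∈Pa) covered = ∧-intro guards-covered products-covered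
  where
  tv = V.map unmarked (P a)
  V′ = coverAllV Cs a tv
  -- Guard bits are marked once the block has been a target, and Cs is nonempty because P a is.
  guards-covered : allCovered (sq (coverWithAll (map blockOf Cs) (blockOf a))) ≡ true
  guards-covered = nonempty-covers Cs (covered x₀∈Pa)
    where
    nonempty-covers : ∀ Cs′ {Q : Reaction _ → Set} → Any Q Cs′ →
      allCovered (sq (coverWithAll (map blockOf Cs′) (blockOf a))) ≡ true
    nonempty-covers (c ∷ cs) _ =
      trans (cong allCovered (sq-upd (blockOf c) (map blockOf cs) (blockOf a))) (allCovered-coverGuards (sq (blockOf a)))
  products-covered : allCovered (sp (coverWithAll (map blockOf Cs) (blockOf a))) ≡ true
  products-covered =
    trans (cong allCovered (sp-upd a Cs (blockOf a) tv (sym (toList-map unmarked (P a))) refl))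
      (implies⇒allCovered V′ λ x → implies-intro _ _ λ x-in-V′ →
        lk-upd3 a Cs tv x (inj₂ (Any.map (λ { {c} (Rc≡⊥ , Ic⊆Ia , x∈Pc) → ⊆⇒guardsImply c a Rc≡⊥ Ic⊆Ia , []=⇒lookup x∈Pc })
          (zip-All-Any rCs (covered (lookup⇒[]= x (P a)
            (trans (sym (trans (lk-upd1 a Cs tv x) (cong proj₁ (lk-pair x (P a))))) x-in-V′)))))))

allBlocksOk⇒covered : ∀ {n} (A B : ReactionSystem n) →
  allBlocksOk (map (coverWithAll (map blockOf B)) (map blockOf A)) ≡ true → All (CoveredBy B) A
allBlocksOk⇒covered [] B ok = []
allBlocksOk⇒covered (a ∷ A) B ok =
  blockOk⇒covered B a (∧-conicalˡ _ _ ok) ∷ allBlocksOk⇒covered A B (∧-conicalʳ _ _ ok)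

covered⇒allBlocksOk : ∀ {n} (A B : ReactionSystem n) → IsReactionSystem A → Reactantless B →
  All (CoveredBy B) A → allBlocksOk (map (coverWithAll (map blockOf B)) (map blockOf A)) ≡ true
covered⇒allBlocksOk [] B [] rB [] = refl
covered⇒allBlocksOk (a ∷ A) B (nonempty ∷ isA) rB (covered ∷ covA) =
  ∧-intro (covered⇒blockOk B a rB nonempty covered) (covered⇒allBlocksOk A B isA rB covA)

verdict⇔mutuallyCovered : ∀ {n} (A B : ReactionSystem n) → IsReactionSystem A → IsReactionSystem B →
  Reactantless A → Reactantless B →
  verdict (map blockOf A) (map blockOf B) ≡ true ⇔ (All (CoveredBy B) A × All (CoveredBy A) B)
verdict⇔mutuallyCovered A B isA isB rA rB = mk⇔
  (λ accepted → let ok = trans (sym verdict≡) accepted in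
     allBlocksOk⇒covered A B (∧-conicalˡ _ _ ok) , allBlocksOk⇒covered B A (∧-conicalʳ _ _ ok))
  (λ (covA , covB) → trans verdict≡ (∧-intro (covered⇒allBlocksOk A B isA rB covA) (covered⇒allBlocksOk B A isB rA covB)))
  where
  verdict≡ = verdict-split (map blockOf A) (map blockOf B)

corollary15 : Σ TM λ M → Σ ℕ λ c → Σ ℕ λ d →
    (n : ℕ) (A B : ReactionSystem n) →
    IsReactionSystem A → IsReactionSystem B →
    Reactantless A → Reactantless B →
    ∃ λ (b : Bool) →
    HaltsWithin M (c * (length (encInstance n A B) + 1) ^ d) (encInstance n A B) b
    × (b ≡ true ⇔ ((T : Subset n) → res A T ≡ res B T))
corollary15 = M , 4 , 2 , λ n A B isA isB rA rB →
  verdict (map blockOf A) (map blockOf B) , M-halts-with-verdict n A B isA isB ,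
  ⇔-sym (res≡⇔mutuallyCovered rA rB) ⇔-∘ verdict⇔mutuallyCovered A B isA isB rA rB
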